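{- Let $k,r,n,s\in\mathbb{N}$ and let $a_1,\ldots,a_k\in\mathbb{Z}$ satisfy $(a_i,n^s)_s=1$ for $i=1,\ldots,k$. Then $$\sum_{\substack{1\le m_1,\ldots,m_k\le n^s\\ (m_i,n^s)_s=1\ (i=1,\ldots,k)\\ 1\le b_1,\ldots,b_r\le n^s}} (m_1-a_1,\ldots,m_k-a_k,b_1,\ldots,b_r,n^s)_s \;=\; \Phi_s(n^s)^k\sum_{d^s\mid n^s}\frac{(d^s)^r}{\Phi_s\!\left(\frac{n^s}{d^s}\right)^{k-1}},$$ where the sum on the left is over integers $m_1,\ldots,m_k,b_1,\ldots,b_r$ in the indicated ranges, and the sum on the right is over positive integers $d$ with $d^s\mid n^s$.
   Context: $\mathbb{N}$ denotes the positive integers. For a positive integer $s$ and integers not all zero, $(x_1,\ldots,x_m)_s$ denotes the largest $l^s$ with $l\in\mathbb{N}$ dividing all of $x_1,\ldots,x_m$ (generalized gcd; for $s=1$ it is the usual gcd). Klee's function $\Phi_s(n)$, for $s,n\in\mathbb{N}$, is the number of integers $m$ with $1\le m\le n$ and $(m,n)_s=1$; equivalently $\Phi_s(n)=n\prod_{p\text{ prime},\,p^s\mid n}(1-p^{ -s})$. -}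

module Defs where

open import Data.Nat as ℕ using (ℕ; zero; suc; _^_; _≡ᵇ_; _⊔_)
open import Data.Nat.Divisibility using (_∣?_)
open import Data.Integer as ℤ using (ℤ; ∣_∣; +_)
open import Data.Nat.ListAction using (sum)
open import Data.List using (List; []; _∷_; [_]; map; foldr; concatMap; all; applyUpTo; _++_)
open import Data.Bool using (Bool; if_then_else_)
open import Data.Vec as Vec using (Vec)
open import Relation.Nullary.Decidable using (⌊_⌋)
open import Data.Rational as ℚ using (ℚ)

range : ℕ → List ℕ
range n = applyUpTo suc n

dividesAll : ℕ → List ℤ → Bool
dividesAll c xs = all (λ x → ⌊ c ∣? ∣ x ∣ ⌋) xs

-- Generalized gcd (x₁,…,xₘ)ₛ : the largest l^s (l ≥ 1) dividing all xᵢ.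
-- Any such l satisfies l ≤ l^s ≤ |xᵢ| for a nonzero xᵢ, so searching
-- l ∈ [1 .. Σ|xᵢ|] suffices (when not all xᵢ are zero).
gcdₛ : ℕ → List ℤ → ℕ
gcdₛ s xs =
  foldr _⊔_ 0
    (map (λ l → if dividesAll (l ^ s) xs then l ^ s else 0)
         (range (sum (map ∣_∣ xs))))

Φ : ℕ → ℕ → ℕ
Φ s n = sum (map (λ m → if gcdₛ s (+ m ∷ + n ∷ []) ≡ᵇ 1 then 1 else 0) (range n))

tuples : (k : ℕ) → ℕ → List (Vec ℕ k)
tuples zero    N = [ Vec.[] ]
tuples (suc k) N = concatMap (λ x → map (x Vec.∷_) (tuples k N)) (range N)

-- natural-number quotient (only used with nonzero divisor)
quot : ℕ → ℕ → ℕ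
quot a zero    = 0
quot a (suc b) = a ℕ./ suc b

-- rational a / b (only used with nonzero b)
frac : ℕ → ℕ → ℚ
frac a zero    = ℚ.0ℚ
frac a (suc b) = (+ a) ℚ./ suc b

lhs : (k r n s : ℕ) → Vec ℤ k → ℕ
lhs k r n s a =
  sum (map (λ m →
    if all (λ mi → gcdₛ s (+ mi ∷ + N ∷ []) ≡ᵇ 1) (Vec.toList m)
    then sum (map (λ b →
           gcdₛ s (Vec.toList (Vec.zipWith (λ mi ai → + mi ℤ.- ai) m a)
                   ++ map +_ (Vec.toList b) ++ [ + N ]))
         (tuples r N))
    else 0)
  (tuples k N))
  where N = n ^ s

-- right-hand side: Φₛ(n^s)^k · Σ_{d ≥ 1, d^s ∣ n^s} (d^s)^r / Φₛ(n^s/d^s)^(k-1)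
-- (d^s ∣ n^s forces d ≤ n, so d ranges over [1 .. n])
rhs : (k r n s : ℕ) → ℚ
rhs k r n s =
  frac (Φ s N ^ k) 1 ℚ.*
  foldr ℚ._+_ ℚ.0ℚ
    (map (λ d → if ⌊ d ^ s ∣? N ⌋
                then frac ((d ^ s) ^ r) (Φ s (quot N (d ^ s)) ^ (k ℕ.∸ 1))
                else ℚ.0ℚ)
         (range n))
  where N = n ^ s

-- Gauss's identity L^s = Σ_{e ∣ L} Φₛ(e^s) expands every generalized gcd as
-- (x₁,…,x_m)ₛ = Σ_{e^s ∣ all xᵢ} Φₛ(e^s). Substituting this and exchanging the sums turns the left-hand
-- side into Σ_{e ∣ n} Φₛ(e^s) · (n^s/e^s)^r · Πᵢ A(aᵢ), where A(a) counts the m ≤ n^s with (m, n^s)ₛ = 1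
-- and m ≡ a (mod e^s).
-- The key lemma is Φₛ(d^s) · A(a) = Φₛ(n^s) for d ∣ n and (a, d^s)ₛ = 1, by strong induction on n.
-- Sorting the (n/d)^s numbers m ≡ a (mod d^s) by g = (m, n^s)ₛ^{1/s} writes (n/d)^s as A(a) plus
-- terms for g > 1; dividing by g^s and multiplying a by an inverse of g^s modulo d^s reduces these
-- to smaller n, so they do not depend on a, and summing over all a coprime to d eliminates them.
-- Re-indexing the divisor sum by e ↦ n/e gives the right-hand side.

module Submission where

open import Algebra.Bundles using (Semiring)
open import Data.Bool using (Bool; true; false; if_then_else_)
open import Data.List using (List; []; _∷_; map; foldr; applyUpTo; concatMap; _++_)
open import Data.List.Properties using (map-++; map-∘; map-cong)
open import Data.Nat as ℕ using (ℕ; zero; suc; _<_; _≤_; s≤s; z≤n; NonZero)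
open import Data.Nat.DivMod using (m*n/n≡m; /-congˡ)
open import Data.Nat.Divisibility using (_∣_; divides; _∣?_; ∣⇒≤; ∣m+n∣m⇒∣n; n∣m*n)
open import Data.Nat.Properties as ℕ using (suc-injective)
import Data.Nat.Tactic.RingSolver as ℕ-Ring
open import Data.Vec as Vec using (Vec; []; _∷_)
open import Defs using (quot; tuples)
open import Function using (_∘_; _$_)
open import Relation.Nullary using (¬_; yes; no; contradiction)
open import Relation.Nullary.Decidable using (⌊_⌋)
import Relation.Binary.PropositionalEquality as ≡
open ≡ using (_≡_; _≢_)

module FiniteSum {c ℓ} (R : Semiring c ℓ) where

  open Semiring R
  open import Algebra.Properties.CommutativeSemigroup +-commutativeSemigroup using (interchange)
  open import Relation.Binary.Reasoning.Setoid setoid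

  ∑ : ℕ → (ℕ → Carrier) → Carrier
  ∑ zero    f = 0#
  ∑ (suc n) f = f 0 + ∑ n (f ∘ suc)

  syntax ∑ n (λ i → e) = ∑[ i < n ] e

  ∑-cong : ∀ n {f g} → (∀ i → i < n → f i ≈ g i) → ∑ n f ≈ ∑ n g
  ∑-cong zero    f≈g = refl
  ∑-cong (suc n) f≈g = +-cong (f≈g 0 (s≤s z≤n)) (∑-cong n λ i i<n → f≈g (suc i) (s≤s i<n))

  ∑-zero : ∀ n f → (∀ i → i < n → f i ≈ 0#) → ∑ n f ≈ 0#
  ∑-zero zero    f f≈0 = refl
  ∑-zero (suc n) f f≈0 =
    trans (+-cong (f≈0 0 (s≤s z≤n)) (∑-zero n (f ∘ suc) λ i i<n → f≈0 (suc i) (s≤s i<n))) (+-identityˡ 0#)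

  ∑-distrib-+ : ∀ n f g → ∑[ i < n ] (f i + g i) ≈ ∑ n f + ∑ n g
  ∑-distrib-+ zero    f g = sym (+-identityˡ 0#)
  ∑-distrib-+ (suc n) f g = trans (+-congˡ (∑-distrib-+ n (f ∘ suc) (g ∘ suc))) (interchange _ _ _ _)

  *-distribˡ-∑ : ∀ n x f → x * ∑ n f ≈ ∑[ i < n ] (x * f i)
  *-distribˡ-∑ zero    x f = zeroʳ x
  *-distribˡ-∑ (suc n) x f = trans (distribˡ x (f 0) _) (+-congˡ (*-distribˡ-∑ n x (f ∘ suc)))

  *-distribʳ-∑ : ∀ n x f → ∑ n f * x ≈ ∑[ i < n ] (f i * x)
  *-distribʳ-∑ zero    x f = zeroˡ x
  *-distribʳ-∑ (suc n) x f = trans (distribʳ x (f 0) _) (+-congˡ (*-distribʳ-∑ n x (f ∘ suc)))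

  ∑-single : ∀ n f j → j < n → (∀ i → i < n → i ≢ j → f i ≈ 0#) → ∑ n f ≈ f j
  ∑-single (suc n) f zero    _         others =
    trans (+-congˡ (∑-zero n (f ∘ suc) λ i i<n → others (suc i) (s≤s i<n) λ ())) (+-identityʳ (f 0))
  ∑-single (suc n) f (suc j) (s≤s j<n) others =
    trans (+-cong (others 0 (s≤s z≤n) λ ())
                  (∑-single n (f ∘ suc) j j<n λ i i<n i≢j → others (suc i) (s≤s i<n) (i≢j ∘ suc-injective)))
          (+-identityˡ (f (suc j)))

  ∑-+ : ∀ m n f → ∑ (m ℕ.+ n) f ≈ ∑ m f + ∑[ i < n ] f (m ℕ.+ i)
  ∑-+ zero    n f = sym (+-identityˡ _)
  ∑-+ (suc m) n f = trans (+-congˡ (∑-+ m n (f ∘ suc))) (sym (+-assoc _ _ _))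

  ∑-truncate : ∀ {m n} f → m ≤ n → (∀ i → m ≤ i → f i ≈ 0#) → ∑ n f ≈ ∑ m f
  ∑-truncate {m} {n} f m≤n tail≈0 = begin
    ∑ n f                                ≡⟨ ≡.cong (λ k → ∑ k f) (≡.sym (ℕ.m+[n∸m]≡n m≤n)) ⟩
    ∑ (m ℕ.+ (n ℕ.∸ m)) f                ≈⟨ ∑-+ m (n ℕ.∸ m) f ⟩
    ∑ m f + ∑[ i < n ℕ.∸ m ] f (m ℕ.+ i) ≈⟨ +-congˡ (∑-zero (n ℕ.∸ m) _ λ i _ → tail≈0 (m ℕ.+ i) (ℕ.m≤m+n m i)) ⟩
    ∑ m f + 0#                           ≈⟨ +-identityʳ _ ⟩
    ∑ m f                                ∎

  ∑-comm : ∀ m n (f : ℕ → ℕ → Carrier) → ∑[ i < m ] ∑[ j < n ] f i j ≈ ∑[ j < n ] ∑[ i < m ] f i j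
  ∑-comm zero    n f = sym (∑-zero n _ λ _ _ → refl)
  ∑-comm (suc m) n f = trans (+-congˡ (∑-comm m n (f ∘ suc))) (sym (∑-distrib-+ n (f 0) _))

  ∑-blocks : ∀ q b f → ∑ (q ℕ.* b) f ≈ ∑[ t < q ] ∑[ i < b ] f (t ℕ.* b ℕ.+ i)
  ∑-blocks zero    b f = refl
  ∑-blocks (suc q) b f = trans (∑-+ b (q ℕ.* b) f) (+-congˡ (begin
    ∑[ i < q ℕ.* b ] f (b ℕ.+ i)                    ≈⟨ ∑-blocks q b (λ i → f (b ℕ.+ i)) ⟩
    ∑[ t < q ] ∑[ i < b ] f (b ℕ.+ (t ℕ.* b ℕ.+ i))  ≈⟨ ∑-cong q (λ t _ → ∑-cong b λ i _ →
                                                         reflexive (≡.cong f (≡.sym (ℕ.+-assoc b _ i)))) ⟩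
    ∑[ t < q ] ∑[ i < b ] f (b ℕ.+ t ℕ.* b ℕ.+ i)    ∎))

  ∑-multiples : ∀ q b .{{_ : NonZero b}} (f : ℕ → Carrier) → (∀ m → ¬ b ∣ m → f m ≈ 0#) →
    ∑[ i < q ℕ.* b ] f (suc i) ≈ ∑[ t < q ] f (b ℕ.* suc t)
  ∑-multiples q b@(suc b-1) f f≈0 =
    trans (∑-blocks q b (f ∘ suc)) (∑-cong q λ t _ →
      trans (∑-single b (λ i → f (suc (t ℕ.* b ℕ.+ i))) b-1 ℕ.≤-refl (offMultiple t)) (atMultiple t))
    where
      offMultiple : ∀ t i → i < b → i ≢ b-1 → f (suc (t ℕ.* b ℕ.+ i)) ≈ 0#
      offMultiple t i (s≤s i≤b-1) i≢b-1 = f≈0 _ λ b∣ → ℕ.<⇒≱ (s≤s (ℕ.≤∧≢⇒< i≤b-1 i≢b-1))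
        (∣⇒≤ (∣m+n∣m⇒∣n (≡.subst (b ∣_) (≡.sym (ℕ.+-suc (t ℕ.* b) i)) b∣) (n∣m*n t)))
      atMultiple : ∀ t → f (suc (t ℕ.* b ℕ.+ b-1)) ≈ f (b ℕ.* suc t)
      atMultiple t = reflexive (≡.cong f (lastInBlock t b-1))
        where
          lastInBlock : ∀ t c → suc (t ℕ.* suc c ℕ.+ c) ≡ suc c ℕ.* suc t
          lastInBlock = ℕ-Ring.solve-∀

  listSum : List Carrier → Carrier
  listSum = foldr _+_ 0#

  listSum-applyUpTo : ∀ n (f : ℕ → Carrier) g → listSum (map f (applyUpTo g n)) ≡ ∑ n (f ∘ g)
  listSum-applyUpTo zero    f g = ≡.refl
  listSum-applyUpTo (suc n) f g = ≡.cong (f (g 0) +_) (listSum-applyUpTo n f (g ∘ suc))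

  listSum-++ : ∀ xs ys → listSum (xs ++ ys) ≈ listSum xs + listSum ys
  listSum-++ []       ys = sym (+-identityˡ _)
  listSum-++ (x ∷ xs) ys = trans (+-congˡ (listSum-++ xs ys)) (sym (+-assoc _ _ _))

  listSum-concatMap : ∀ {a b} {B : Set a} {C : Set b} (h : C → Carrier) (F : B → List C) xs →
    listSum (map h (concatMap F xs)) ≈ listSum (map (λ x → listSum (map h (F x))) xs)
  listSum-concatMap h F []       = refl
  listSum-concatMap h F (x ∷ xs) = begin
    listSum (map h (F x ++ concatMap F xs))                  ≡⟨ ≡.cong listSum (map-++ h (F x) _) ⟩
    listSum (map h (F x) ++ map h (concatMap F xs))          ≈⟨ listSum-++ (map h (F x)) _ ⟩
    listSum (map h (F x)) + listSum (map h (concatMap F xs)) ≈⟨ +-congˡ (listSum-concatMap h F xs) ⟩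
    listSum (map (λ x → listSum (map h (F x))) (x ∷ xs))     ∎

  listSum-cong : ∀ {a} {B : Set a} {f g : B → Carrier} xs →
    (∀ x → f x ≈ g x) → listSum (map f xs) ≈ listSum (map g xs)
  listSum-cong []       f≈g = refl
  listSum-cong (x ∷ xs) f≈g = +-cong (f≈g x) (listSum-cong xs f≈g)

  *-distribˡ-listSum : ∀ {a} {B : Set a} x (f : B → Carrier) xs →
    x * listSum (map f xs) ≈ listSum (map (λ y → x * f y) xs)
  *-distribˡ-listSum x f []       = zeroʳ x
  *-distribˡ-listSum x f (y ∷ ys) = trans (distribˡ x (f y) _) (+-congˡ (*-distribˡ-listSum x f ys))

  *-distribʳ-listSum : ∀ {a} {B : Set a} x (f : B → Carrier) xs →
    listSum (map f xs) * x ≈ listSum (map (λ y → f y * x) xs)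
  *-distribʳ-listSum x f []       = zeroˡ x
  *-distribʳ-listSum x f (y ∷ ys) = trans (distribʳ x (f y) _) (+-congˡ (*-distribʳ-listSum x f ys))

  listSum-∑ : ∀ {a} {B : Set a} n (F : B → ℕ → Carrier) xs →
    listSum (map (λ x → ∑ n (F x)) xs) ≈ ∑[ i < n ] listSum (map (λ x → F x i) xs)
  listSum-∑ n F []       = sym (∑-zero n _ λ _ _ → refl)
  listSum-∑ n F (x ∷ xs) = trans (+-congˡ (listSum-∑ n F xs)) (sym (∑-distrib-+ n (F x) _))

  ∏ : ∀ {k} → Vec Carrier k → Carrier
  ∏ []       = 1#
  ∏ (x ∷ xs) = x * ∏ xs

  listSum-tuples : ∀ k N (F : Vec ℕ (suc k) → Carrier) →
    listSum (map F (tuples (suc k) N)) ≈ ∑[ i < N ] listSum (map (λ m → F (suc i ∷ m)) (tuples k N))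
  listSum-tuples k N F = begin
    listSum (map F (concatMap (λ x → map (x ∷_) (tuples k N)) (applyUpTo suc N)))
      ≈⟨ listSum-concatMap F (λ x → map (x ∷_) (tuples k N)) (applyUpTo suc N) ⟩
    listSum (map (λ x → listSum (map F (map (x ∷_) (tuples k N)))) (applyUpTo suc N))
      ≡⟨ ≡.cong listSum (map-cong (λ x → ≡.cong listSum (≡.sym (map-∘ (tuples k N)))) (applyUpTo suc N)) ⟩
    listSum (map (λ x → listSum (map (λ m → F (x ∷ m)) (tuples k N))) (applyUpTo suc N))
      ≡⟨ listSum-applyUpTo N _ suc ⟩
    ∑[ i < N ] listSum (map (λ m → F (suc i ∷ m)) (tuples k N))
      ∎

  listSum-tuples-∏ : ∀ k N (fs : Vec (ℕ → Carrier) k) →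
    listSum (map (λ m → ∏ (Vec.zipWith _$_ fs m)) (tuples k N)) ≈ ∏ (Vec.map (λ f → ∑[ i < N ] f (suc i)) fs)
  listSum-tuples-∏ zero    N []       = +-identityʳ 1#
  listSum-tuples-∏ (suc k) N (f ∷ fs) = begin
    listSum (map (λ m → ∏ (Vec.zipWith _$_ (f ∷ fs) m)) (tuples (suc k) N))
      ≈⟨ listSum-tuples k N _ ⟩
    ∑[ i < N ] listSum (map (λ m → f (suc i) * ∏ (Vec.zipWith _$_ fs m)) (tuples k N))
      ≈⟨ ∑-cong N (λ i _ → sym (*-distribˡ-listSum (f (suc i)) _ (tuples k N))) ⟩
    ∑[ i < N ] (f (suc i) * listSum (map (λ m → ∏ (Vec.zipWith _$_ fs m)) (tuples k N)))
      ≈⟨ sym (*-distribʳ-∑ N _ (f ∘ suc)) ⟩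
    ∑[ i < N ] f (suc i) * listSum (map (λ m → ∏ (Vec.zipWith _$_ fs m)) (tuples k N))
      ≈⟨ *-congˡ (listSum-tuples-∏ k N fs) ⟩
    ∏ (Vec.map (λ f → ∑[ i < N ] f (suc i)) (f ∷ fs))
      ∎

  *-if : ∀ x b y → x * (if b then y else 0#) ≈ (if b then x * y else 0#)
  *-if x true  y = refl
  *-if x false y = zeroʳ x

  if-cong : ∀ b {x y} → (b ≡ true → x ≈ y) → (if b then x else 0#) ≈ (if b then y else 0#)
  if-cong true  x≈y = x≈y ≡.refl
  if-cong false _   = refl

  ∑-dvd : ℕ → (ℕ → Carrier) → Carrier
  ∑-dvd n F = ∑[ e < n ] (if ⌊ suc e ∣? n ⌋ then F (suc e) else 0#)

  syntax ∑-dvd n (λ d → e) = ∑[ d ∣ n ] e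

  ∑-cofactor : ∀ n d F → 1 ≤ n →
    ∑[ e < n ] (if ⌊ suc d ℕ.* suc e ℕ.≟ n ⌋ then F (suc e) else 0#) ≈
    (if ⌊ suc d ∣? n ⌋ then F (quot n (suc d)) else 0#)
  ∑-cofactor n d F 1≤n with suc d ∣? n
  ... | no d∤n = ∑-zero n _ noCofactor
    where
      noCofactor : ∀ e → e < n → (if ⌊ suc d ℕ.* suc e ℕ.≟ n ⌋ then F (suc e) else 0#) ≈ 0#
      noCofactor e _ with suc d ℕ.* suc e ℕ.≟ n
      ... | yes de≡n = contradiction (divides (suc e) (≡.trans (≡.sym de≡n) (ℕ.*-comm (suc d) (suc e)))) d∤n
      ... | no  _    = refl
  ... | yes (divides zero    n≡0) = contradiction n≡0 (ℕ.m<n⇒n≢0 1≤n)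
  ... | yes (divides (suc q) n≡qd) = trans (∑-single n _ q q<n others) atCofactor
    where
      q<n : q < n
      q<n = ≡.subst (suc q ≤_) (≡.sym n≡qd) (ℕ.m≤m*n (suc q) (suc d))
      others : ∀ e → e < n → e ≢ q → (if ⌊ suc d ℕ.* suc e ℕ.≟ n ⌋ then F (suc e) else 0#) ≈ 0#
      others e _ e≢q with suc d ℕ.* suc e ℕ.≟ n
      ... | no  _    = refl
      ... | yes de≡n = contradiction (suc-injective (ℕ.*-cancelˡ-≡ (suc e) (suc q) (suc d)
                          (≡.trans de≡n (≡.trans n≡qd (ℕ.*-comm (suc q) (suc d)))))) e≢q
      atCofactor : (if ⌊ suc d ℕ.* suc q ℕ.≟ n ⌋ then F (suc q) else 0#) ≈ F (quot n (suc d))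
      atCofactor with suc d ℕ.* suc q ℕ.≟ n
      ... | no dq≢n = contradiction (≡.trans (ℕ.*-comm (suc d) (suc q)) (≡.sym n≡qd)) dq≢n
      ... | yes _   = reflexive (≡.cong F (≡.sym (≡.trans (/-congˡ n≡qd) (m*n/n≡m (suc q) (suc d)))))

  ∑-dvd-flip : ∀ n F → 1 ≤ n → ∑[ d ∣ n ] F (quot n d) ≈ ∑[ d ∣ n ] F d
  ∑-dvd-flip n F 1≤n = begin
    ∑[ d ∣ n ] F (quot n d)
      ≈⟨ ∑-cong n (λ d _ → sym (∑-cofactor n d F 1≤n)) ⟩
    ∑[ d < n ] ∑[ e < n ] (if ⌊ suc d ℕ.* suc e ℕ.≟ n ⌋ then F (suc e) else 0#)
      ≈⟨ ∑-comm n n _ ⟩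
    ∑[ e < n ] ∑[ d < n ] (if ⌊ suc d ℕ.* suc e ℕ.≟ n ⌋ then F (suc e) else 0#)
      ≈⟨ ∑-cong n (λ e _ → trans (∑-cong n λ d _ → reflexive (commute d e)) (∑-cofactor n e (λ _ → F (suc e)) 1≤n)) ⟩
    ∑[ d ∣ n ] F d
      ∎
    where
      commute : ∀ d e → (if ⌊ suc d ℕ.* suc e ℕ.≟ n ⌋ then F (suc e) else 0#) ≡
                        (if ⌊ suc e ℕ.* suc d ℕ.≟ n ⌋ then F (suc e) else 0#)
      commute d e = ≡.cong (λ m → if ⌊ m ℕ.≟ n ⌋ then F (suc e) else 0#) (ℕ.*-comm (suc d) (suc e))

open import Algebra.Bundles using (CommutativeRing)
open import Data.Bool using (_∧_)
open import Data.Bool.Properties using (∧-assoc)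
open import Data.Fin using (Fin)
import Data.Fin as Fin
open import Data.Integer as ℤ using (ℤ; ∣_∣; +_; -_; _⊖_)
import Data.Integer.Properties as ℤ
open import Data.Integer.DivMod using (_%ℕ_; _/ℕ_; n%ℕd<d; a≡a%ℕn+[a/ℕn]*n)
open import Data.Integer.Divisibility.Signed as ℤ∣ using (divides; ∣ᵤ⇒∣; ∣⇒∣ᵤ) renaming (_∣_ to _∣ℤ_)
import Data.Integer.Tactic.RingSolver as ℤ-Ring
open import Data.List using (all)
open import Data.List.Membership.Propositional using (_∈_)
open import Data.List.Membership.Propositional.Properties using (∈-map⁺; ∈-map⁻; ∈-applyUpTo⁺; ∈-applyUpTo⁻; ∈-++⁺ʳ)
open import Data.List.Relation.Unary.All as All using (All; []; _∷_)
open import Data.List.Relation.Unary.Any using (here; there)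
open import Data.Nat
open import Data.Nat.Coprimality using (Coprime; coprime-divisor; coprime-/gcd; coprime-Bézout; gcd≡1⇒coprime)
import Data.Nat.Coprimality as Coprime
open import Data.Nat.Divisibility
open import Data.Nat.DivMod using (m/n*n≡m)
open import Data.Nat.GCD using (gcd; gcd[m,n]∣m; gcd[m,n]∣n; gcd[m,n]≢0; module Bézout)
open import Data.Nat.Induction using (<-rec)
open import Data.Nat.ListAction using (sum)
open import Data.Nat.Properties
open import Algebra.Properties.CommutativeSemigroup *-commutativeSemigroup using (interchange; x∙yz≈y∙xz; xy∙z≈xz∙y)
open import Data.Product using (∃; _×_; _,_; proj₁; proj₂)
open import Data.Rational as ℚ using (ℚ; 0ℚ)
import Data.Rational.Properties as ℚ
open import Data.Rational.Unnormalised as ℚᵘ using (mkℚᵘ; *≡*)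
import Data.Rational.Unnormalised.Properties as ℚᵘ
open import Data.Sum using (_⊎_; inj₁; inj₂)
open import Data.Vec using (lookup)
import Data.Vec.Properties as Vec
open import Defs
open import Function using (_∘′_)
open import Function.Bundles using (_⇔_; mk⇔; Equivalence)
open import Relation.Binary.PropositionalEquality
open import Relation.Nullary using (Dec; map′)
open import Relation.Nullary.Decidable using (isYes≗does)

open FiniteSum +-*-semiring

∑-1 : ∀ n → ∑[ _ < n ] 1 ≡ n
∑-1 zero    = refl
∑-1 (suc n) = cong suc (∑-1 n)

-- Powers and coprimality

^-distribʳ-* : ∀ m n k → (m * n) ^ k ≡ m ^ k * n ^ k
^-distribʳ-* m n zero    = refl
^-distribʳ-* m n (suc k) =
  trans (cong (m * n *_) (^-distribʳ-* m n k)) (interchange m n (m ^ k) (n ^ k))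

^-monoˡ-∣ : ∀ {m n} k → m ∣ n → m ^ k ∣ n ^ k
^-monoˡ-∣ zero    m∣n = ∣-refl
^-monoˡ-∣ (suc k) m∣n = *-pres-∣ m∣n (^-monoˡ-∣ k m∣n)

coprime-* : ∀ {a b c} → Coprime a b → Coprime a c → Coprime a (b * c)
coprime-* {b = b} a⊥b a⊥c {d} (d∣a , d∣bc) = a⊥c (d∣a , coprime-divisor d⊥b d∣bc)
  where
    d⊥b : Coprime d b
    d⊥b (x∣d , x∣b) = a⊥b (∣-trans x∣d d∣a , x∣b)

coprime-^ʳ : ∀ {a b} k → Coprime a b → Coprime a (b ^ k)
coprime-^ʳ zero    a⊥b (_ , x∣1) = ∣1⇒≡1 x∣1
coprime-^ʳ (suc k) a⊥b = coprime-* a⊥b (coprime-^ʳ k a⊥b)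

coprime-^ : ∀ {a b} k → Coprime a b → Coprime (a ^ k) (b ^ k)
coprime-^ k a⊥b = coprime-^ʳ k (Coprime.sym (coprime-^ʳ k (Coprime.sym a⊥b)))

record CoprimeSplit (m n : ℕ) : Set where
  constructor split
  field
    m′ n′ g : ℕ
    .{{g≢0}} : NonZero g
    m≡m′*g   : m ≡ m′ * g
    n≡n′*g   : n ≡ n′ * g
    coprime  : Coprime m′ n′

coprimeSplit : ∀ m n .{{_ : NonZero n}} → CoprimeSplit m n
coprimeSplit m n = split (m / g) (n / g) g
  (sym (m/n*n≡m (gcd[m,n]∣m m n))) (sym (m/n*n≡m (gcd[m,n]∣n m n))) (coprime-/gcd m n)
  where
    g = gcd m n
    instance _ = ≢-nonZero (gcd[m,n]≢0 m n (inj₂ (≢-nonZero⁻¹ n)))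

coprimeSplit-^-cancel : ∀ {m n} k (sp : CoprimeSplit m n) o →
  m ^ k ∣ n ^ k * o → CoprimeSplit.m′ sp ^ k ∣ o
coprimeSplit-^-cancel k (split m′ n′ g refl refl m′⊥n′) o m^k∣n^ko =
  coprime-divisor (coprime-^ k m′⊥n′) (*-cancelʳ-∣ (g ^ k) {{m^n≢0 g k}} (subst₂ _∣_
    (^-distribʳ-* m′ g k)
    (trans (cong (_* o) (^-distribʳ-* n′ g k)) (xy∙z≈xz∙y (n′ ^ k) (g ^ k) o))
    m^k∣n^ko))

module _ {k : ℕ} .{{_ : NonZero k}} where

  m^k≡1⇒m≡1 : ∀ m → m ^ k ≡ 1 → m ≡ 1
  m^k≡1⇒m≡1 m m^k≡1 with m^n≡1⇒n≡0∨m≡1 m k m^k≡1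
  ... | inj₁ k≡0 = contradiction k≡0 (≢-nonZero⁻¹ k)
  ... | inj₂ m≡1 = m≡1

  m^k∣n^k⇒m∣n : ∀ {m n} .{{_ : NonZero n}} → m ^ k ∣ n ^ k → m ∣ n
  m^k∣n^k⇒m∣n {m} {n} m^k∣n^k with coprimeSplit m n
  ... | sp@(split m′ n′ g m≡m′*g n≡n′*g _) = subst (_∣ n) (sym m≡g) (divides n′ n≡n′*g)
    where
      m′≡1 : m′ ≡ 1
      m′≡1 = m^k≡1⇒m≡1 m′ (∣1⇒≡1 (coprimeSplit-^-cancel k sp 1 (subst (m ^ k ∣_) (sym (*-identityʳ _)) m^k∣n^k)))
      m≡g : m ≡ g
      m≡g = trans m≡m′*g (trans (cong (_* g) m′≡1) (*-identityˡ g))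

  m≤m^k : ∀ m → m ≤ m ^ k
  m≤m^k zero        = z≤n
  m≤m^k m@(suc _) = subst (_≤ m ^ k) (^-identityʳ m) (^-monoʳ-≤ m (>-nonZero⁻¹ k))

  ^-cancelˡ-≤ : ∀ {m n} → m ^ k ≤ n ^ k → m ≤ n
  ^-cancelˡ-≤ {m} {n} m^k≤n^k with m ≤? n
  ... | yes m≤n = m≤n
  ... | no  m≰n = contradiction m^k≤n^k (<⇒≱ (^-monoˡ-< k (≰⇒> m≰n)))

0^k≡0 : ∀ k .{{_ : NonZero k}} → 0 ^ k ≡ 0
0^k≡0 (suc k) = refl

divisor≢0 : ∀ {d n} .{{_ : NonZero n}} → d ∣ n → NonZero d
divisor≢0 {zero}  0∣n = contradiction (0∣⇒≡0 0∣n) (≢-nonZero⁻¹ _)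
divisor≢0 {suc _} _   = _

cofactor≢0 : ∀ {n q d} .{{_ : NonZero n}} → n ≡ q * d → NonZero q
cofactor≢0 {q = q} {d} n≡qd = divisor≢0 (divides d (trans n≡qd (*-comm q d)))

quot-cofactor : ∀ {n q d} .{{_ : NonZero d}} → n ≡ q * d → quot n d ≡ q
quot-cofactor {d = suc _} refl = m*n/n≡m _ _

⌊⌋-true : ∀ {p} {P : Set p} (p? : Dec P) → P → ⌊ p? ⌋ ≡ true
⌊⌋-true (yes _) _ = refl
⌊⌋-true (no ¬p) p = contradiction p ¬p

⌊⌋-false : ∀ {p} {P : Set p} (p? : Dec P) → ¬ P → ⌊ p? ⌋ ≡ false
⌊⌋-false (yes p) ¬p = contradiction p ¬p
⌊⌋-false (no _)  _  = refl

⌊⌋-true⁻¹ : ∀ {p} {P : Set p} (p? : Dec P) → ⌊ p? ⌋ ≡ true → P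
⌊⌋-true⁻¹ (yes p) _ = p

⌊⌋-cong : ∀ {p q} {P : Set p} {Q : Set q} (p? : Dec P) (q? : Dec Q) → (P → Q) → (Q → P) → ⌊ p? ⌋ ≡ ⌊ q? ⌋
⌊⌋-cong (yes _) (yes _) _   _   = refl
⌊⌋-cong (no _)  (no _)  _   _   = refl
⌊⌋-cong (yes p) (no ¬q) P→Q _   = contradiction (P→Q p) ¬q
⌊⌋-cong (no ¬p) (yes q) _   Q→P = contradiction (Q→P q) ¬p

𝟙 : Bool → ℕ
𝟙 b = if b then 1 else 0

𝟙-∧ : ∀ a b → 𝟙 (a ∧ b) ≡ 𝟙 a * 𝟙 b
𝟙-∧ true  b = sym (+-identityʳ (𝟙 b))
𝟙-∧ false b = refl

𝟙-* : ∀ b x → 𝟙 b * x ≡ (if b then x else 0)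
𝟙-* true  x = +-identityʳ x
𝟙-* false x = refl

∑-𝟙≟ : ∀ n l .{{_ : NonZero l}} x → l ≤ n → ∑[ g < n ] (𝟙 ⌊ suc g ≟ l ⌋ * x) ≡ x
∑-𝟙≟ n (suc l) x l<n = trans (∑-single n (λ g → 𝟙 ⌊ suc g ≟ suc l ⌋ * x) l l<n others)
                              (trans (cong (λ b → 𝟙 b * x) (⌊⌋-true (suc l ≟ suc l) refl)) (+-identityʳ x))
  where
    others : ∀ g → g < n → g ≢ l → 𝟙 ⌊ suc g ≟ suc l ⌋ * x ≡ 0
    others g _ g≢l = cong (λ b → 𝟙 b * x) (⌊⌋-false (suc g ≟ suc l) (g≢l ∘′ suc-injective))

-- The generalized gcd

DividesAll : ℕ → List ℤ → Set
DividesAll c = All (λ x → c ∣ ∣ x ∣)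

dividesAll≡⌊all?⌋ : ∀ c xs → dividesAll c xs ≡ ⌊ All.all? (λ x → c ∣? ∣ x ∣) xs ⌋
dividesAll≡⌊all?⌋ c []       = refl
dividesAll≡⌊all?⌋ c (x ∷ xs) with c ∣? ∣ x ∣ | All.all? (λ x → c ∣? ∣ x ∣) xs | dividesAll≡⌊all?⌋ c xs
... | yes _ | yes _ | eq = eq
... | yes _ | no _  | eq = eq
... | no _  | _     | _  = refl

dividesAll⇒ : ∀ c xs → dividesAll c xs ≡ true → DividesAll c xs
dividesAll⇒ c xs eq = ⌊⌋-true⁻¹ (All.all? (λ x → c ∣? ∣ x ∣) xs) (trans (sym (dividesAll≡⌊all?⌋ c xs)) eq)

∈⇒≤sum : ∀ {x xs} → x ∈ xs → x ≤ sum xs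
∈⇒≤sum (here refl) = m≤m+n _ _
∈⇒≤sum (there x∈xs) = ≤-trans (∈⇒≤sum x∈xs) (m≤n+m _ _)

∈⇒≤foldr-⊔ : ∀ {x xs} → x ∈ xs → x ≤ foldr _⊔_ 0 xs
∈⇒≤foldr-⊔ (here refl) = m≤m⊔n _ _
∈⇒≤foldr-⊔ (there x∈xs) = ≤-trans (∈⇒≤foldr-⊔ x∈xs) (m≤n⊔m _ _)

foldr-⊔-sel : ∀ xs → foldr _⊔_ 0 xs ≡ 0 ⊎ foldr _⊔_ 0 xs ∈ xs
foldr-⊔-sel []       = inj₁ refl
foldr-⊔-sel (x ∷ xs) with ⊔-sel x (foldr _⊔_ 0 xs) | foldr-⊔-sel xs
... | inj₁ max≡x | _             = inj₂ (here max≡x)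
... | inj₂ max≡m | inj₁ m≡0      = inj₁ (trans max≡m m≡0)
... | inj₂ max≡m | inj₂ m∈xs     = inj₂ (there (subst (_∈ xs) (sym max≡m) m∈xs))

module _ (s : ℕ) .{{_ : NonZero s}} where

  record GcdRoot (xs : List ℤ) : Set where
    field
      root        : ℕ
      root≢0      : NonZero root
      gcdₛ≡root^s : gcdₛ s xs ≡ root ^ s
      root^s∣xs   : DividesAll (root ^ s) xs
      greatest    : ∀ e → DividesAll (e ^ s) xs → e ∣ root

  module _ (xs : List ℤ) {x} (x∈xs : x ∈ xs) .{{_ : NonZero ∣ x ∣}} where

    private
      candidate : ℕ → ℕ
      candidate l = if dividesAll (l ^ s) xs then l ^ s else 0

      candidate-common : ∀ c → DividesAll (c ^ s) xs → candidate c ≡ c ^ s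
      candidate-common c c^s∣xs
        rewrite dividesAll≡⌊all?⌋ (c ^ s) xs | ⌊⌋-true (All.all? (λ x → c ^ s ∣? ∣ x ∣) xs) c^s∣xs = refl

    gcdₛ-upper : ∀ c .{{_ : NonZero c}} → DividesAll (c ^ s) xs → c ^ s ≤ gcdₛ s xs
    gcdₛ-upper c@(suc c-1) c^s∣xs = subst (_≤ gcdₛ s xs) (candidate-common c c^s∣xs)
      (∈⇒≤foldr-⊔ (∈-map⁺ candidate (∈-applyUpTo⁺ suc c≤bound)))
      where
        c≤bound : c ≤ sum (map ∣_∣ xs)
        c≤bound = ≤-trans (m≤m^k c) (≤-trans (∣⇒≤ (All.lookup c^s∣xs x∈xs)) (∈⇒≤sum (∈-map⁺ ∣_∣ x∈xs)))

    gcdₛ≢0 : gcdₛ s xs ≢ 0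
    gcdₛ≢0 = m<n⇒n≢0 (subst (_≤ gcdₛ s xs) (^-zeroˡ s) (gcdₛ-upper 1 1^s∣xs))
      where 1^s∣xs = All.tabulate λ {y} _ → subst (_∣ ∣ y ∣) (sym (^-zeroˡ s)) (1∣ ∣ y ∣)

    gcdₛ-attained : ∃ λ l → NonZero l × gcdₛ s xs ≡ l ^ s × DividesAll (l ^ s) xs
    gcdₛ-attained with foldr-⊔-sel (map candidate (range (sum (map ∣_∣ xs))))
    ... | inj₁ gcd≡0 = contradiction gcd≡0 gcdₛ≢0
    ... | inj₂ gcd∈ with ∈-map⁻ candidate gcd∈
    ...   | l , l∈range , gcd≡candidate with ∈-applyUpTo⁻ suc l∈range
    ...     | _ , _ , refl with dividesAll (l ^ s) xs in l^s∣xs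
    ...       | true  = l , _ , gcd≡candidate , dividesAll⇒ (l ^ s) xs l^s∣xs
    ...       | false = contradiction gcd≡candidate gcdₛ≢0

    nonZero-common : ∀ e → DividesAll (e ^ s) xs → NonZero e
    nonZero-common zero    0∣xs =
      contradiction (0∣⇒≡0 (subst (_∣ ∣ x ∣) (0^k≡0 s) (All.lookup 0∣xs x∈xs))) (≢-nonZero⁻¹ ∣ x ∣)
    nonZero-common (suc _) _    = _

    gcdₛ-root : GcdRoot xs
    gcdₛ-root with gcdₛ-attained
    ... | L , L≢0 , gcd≡L^s , L^s∣xs = record
      { root = L ; root≢0 = L≢0 ; gcdₛ≡root^s = gcd≡L^s ; root^s∣xs = L^s∣xs ; greatest = greatest }
      where
        instance _ = L≢0
        greatest : ∀ e → DividesAll (e ^ s) xs → e ∣ L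
        greatest e e^s∣xs with coprimeSplit e L | nonZero-common e e^s∣xs
        ... | sp@(split e′ L′ g refl refl _) | e≢0 = subst (e ∣_) c≡L (*-monoʳ-∣ e′ (n∣m*n L′))
          where
            -- c is lcm(e, L); its s-th power divides xs, so maximality of L forces c = L
            c = e′ * L
            instance
              _ : NonZero c
              _ = m*n≢0 e′ L {{m*n≢0⇒m≢0 e′ {{e≢0}}}}
            lcm^s∣ : ∀ {y} → e ^ s ∣ y → L ^ s ∣ y → c ^ s ∣ y
            lcm^s∣ e^s∣y (divides q refl) = subst (_∣ _) (sym (^-distribʳ-* e′ L s))
              (*-monoˡ-∣ (L ^ s) (coprimeSplit-^-cancel s sp q (subst (e ^ s ∣_) (*-comm q (L ^ s)) e^s∣y)))
            c≤L : c ≤ L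
            c≤L = ^-cancelˡ-≤ (≤-trans (gcdₛ-upper c (All.zipWith (λ (p , q) → lcm^s∣ p q) (e^s∣xs , L^s∣xs)))
                                       (≤-reflexive gcd≡L^s))
            c≡L : c ≡ L
            c≡L = ≤-antisym c≤L (∣⇒≤ (n∣m*n e′))

  Coprimeₛ : ℕ → ℤ → Set
  Coprimeₛ n a = ∀ e → e ∣ n → e ^ s ∣ ∣ a ∣ → e ≡ 1

  module _ (n : ℕ) .{{_ : NonZero n}} (a : ℤ) where

    private
      instance _ = m^n≢0 n s
      G = gcdₛ-root (a ∷ + (n ^ s) ∷ []) (there (here refl))
      open GcdRoot G

    gcdRoot : ℕ
    gcdRoot = root

    gcdRoot≢0 : NonZero gcdRoot
    gcdRoot≢0 = root≢0

    gcdRoot^s∣a : gcdRoot ^ s ∣ ∣ a ∣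
    gcdRoot^s∣a with root^s∣xs
    ... | root^s∣a ∷ _ = root^s∣a

    gcdRoot∣n : gcdRoot ∣ n
    gcdRoot∣n with root^s∣xs
    ... | _ ∷ root^s∣n^s ∷ [] = m^k∣n^k⇒m∣n root^s∣n^s

    gcdRoot-greatest : ∀ {e} → e ∣ n → e ^ s ∣ ∣ a ∣ → e ∣ gcdRoot
    gcdRoot-greatest e∣n e^s∣a = greatest _ (e^s∣a ∷ ^-monoˡ-∣ s e∣n ∷ [])

    gcdₛ≡1⇔Coprimeₛ : gcdₛ s (a ∷ + (n ^ s) ∷ []) ≡ 1 ⇔ Coprimeₛ n a
    gcdₛ≡1⇔Coprimeₛ = mk⇔
      (λ gcd≡1 e e∣n e^s∣a → ∣1⇒≡1 (subst (e ∣_) (m^k≡1⇒m≡1 root (trans (sym gcdₛ≡root^s) gcd≡1))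
                                                   (gcdRoot-greatest e∣n e^s∣a)))
      (λ coprime → trans gcdₛ≡root^s (trans (cong (_^ s) (coprime root gcdRoot∣n gcdRoot^s∣a)) (^-zeroˡ s)))

  Coprimeₛ? : ∀ n .{{_ : NonZero n}} a → Dec (Coprimeₛ n a)
  Coprimeₛ? n a = map′ to from (gcdₛ s (a ∷ + (n ^ s) ∷ []) ≟ 1)
    where open Equivalence (gcdₛ≡1⇔Coprimeₛ n a)

  coprimeᵇ : ℕ → ℕ → Bool
  coprimeᵇ n m = gcdₛ s (+ m ∷ + (n ^ s) ∷ []) ≡ᵇ 1

  coprimeᵇ≡⌊Coprimeₛ?⌋ : ∀ n .{{_ : NonZero n}} m → coprimeᵇ n m ≡ ⌊ Coprimeₛ? n (+ m) ⌋
  coprimeᵇ≡⌊Coprimeₛ?⌋ n m = sym (isYes≗does (Coprimeₛ? n (+ m)))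

  coprimeᵇ⇒Coprimeₛ : ∀ n .{{_ : NonZero n}} m → coprimeᵇ n m ≡ true → Coprimeₛ n (+ m)
  coprimeᵇ⇒Coprimeₛ n m m⊥n = ⌊⌋-true⁻¹ (Coprimeₛ? n (+ m)) (trans (sym (coprimeᵇ≡⌊Coprimeₛ?⌋ n m)) m⊥n)

  Coprimeₛ⇒coprimeᵇ : ∀ n .{{_ : NonZero n}} m → Coprimeₛ n (+ m) → coprimeᵇ n m ≡ true
  Coprimeₛ⇒coprimeᵇ n m m⊥n = trans (coprimeᵇ≡⌊Coprimeₛ?⌋ n m) (⌊⌋-true (Coprimeₛ? n (+ m)) m⊥n)

  gcdRoot-scaled≡⇔Coprimeₛ : ∀ n .{{_ : NonZero n}} q g .{{_ : NonZero g}} → n ≡ q * g → ∀ m →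
    gcdRoot n (+ (g ^ s * m)) ≡ g ⇔ Coprimeₛ q (+ m)
  gcdRoot-scaled≡⇔Coprimeₛ n q g n≡qg m = mk⇔ to from
    where
      L = gcdRoot n (+ (g ^ s * m))
      g∣L : g ∣ L
      g∣L = gcdRoot-greatest n (+ (g ^ s * m)) (divides q n≡qg) (m∣m*n m)

      to : L ≡ g → Coprimeₛ q (+ m)
      to L≡g e e∣q e^s∣m = ∣1⇒≡1 (*-cancelʳ-∣ g (subst (e * g ∣_) (trans L≡g (sym (*-identityˡ g))) eg∣L))
        where
          eg∣L : e * g ∣ L
          eg∣L = gcdRoot-greatest n (+ (g ^ s * m)) (subst (e * g ∣_) (sym n≡qg) (*-monoˡ-∣ g e∣q))
            (subst₂ _∣_ (sym (^-distribʳ-* e g s)) (*-comm m (g ^ s)) (*-monoˡ-∣ (g ^ s) e^s∣m))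

      from : Coprimeₛ q (+ m) → L ≡ g
      from coprime = ∣-antisym L∣g g∣L
        where
          L∣g : L ∣ g
          L∣g with coprimeSplit L g
          ... | sp@(split e′ g′ h L≡e′h g≡g′h e′⊥g′) = subst (_∣ g) (sym L≡h) (divides g′ g≡g′h)
            where
              e′^s∣m : e′ ^ s ∣ m
              e′^s∣m = coprimeSplit-^-cancel s sp m (gcdRoot^s∣a n (+ (g ^ s * m)))
              e′∣q : e′ ∣ q
              e′∣q = coprime-divisor e′⊥g′ (*-cancelʳ-∣ h (subst₂ _∣_ L≡e′h n≡g′qh (gcdRoot∣n n (+ (g ^ s * m)))))
                where
                  n≡g′qh : n ≡ g′ * q * h
                  n≡g′qh = trans n≡qg (trans (cong (q *_) g≡g′h)
                             (trans (sym (*-assoc q g′ h)) (cong (_* h) (*-comm q g′))))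
              L≡h : L ≡ h
              L≡h = trans L≡e′h (trans (cong (_* h) (coprime e′ e′∣q e′^s∣m)) (*-identityˡ h))

  ∑-gcdRoot≡ : ∀ n .{{_ : NonZero n}} q g .{{_ : NonZero g}} → n ≡ q * g → (f : ℕ → ℕ) →
    ∑[ i < n ^ s ] (𝟙 ⌊ g ≟ gcdRoot n (+ suc i) ⌋ * f (suc i)) ≡
    ∑[ j < q ^ s ] (𝟙 (coprimeᵇ q (suc j)) * f (g ^ s * suc j))
  ∑-gcdRoot≡ n q g n≡qg f = begin
    ∑[ i < n ^ s ] h (suc i)
      ≡⟨ cong (λ k → ∑[ i < k ] h (suc i)) n^s≡q^sG ⟩
    ∑[ i < q ^ s * g ^ s ] h (suc i)
      ≡⟨ ∑-multiples (q ^ s) (g ^ s) h offMultiple ⟩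
    ∑[ j < q ^ s ] h (g ^ s * suc j)
      ≡⟨ ∑-cong (q ^ s) (λ j _ → cong (λ b → 𝟙 b * f (g ^ s * suc j)) (onMultiple j)) ⟩
    ∑[ j < q ^ s ] (𝟙 (coprimeᵇ q (suc j)) * f (g ^ s * suc j))
      ∎
    where
      open ≡-Reasoning
      instance
        _ = m^n≢0 g s
        _ = cofactor≢0 n≡qg
      h : ℕ → ℕ
      h m = 𝟙 ⌊ g ≟ gcdRoot n (+ m) ⌋ * f m
      n^s≡q^sG : n ^ s ≡ q ^ s * g ^ s
      n^s≡q^sG = trans (cong (_^ s) n≡qg) (^-distribʳ-* q g s)
      offMultiple : ∀ m → ¬ g ^ s ∣ m → h m ≡ 0
      offMultiple m G∤m = cong (λ b → 𝟙 b * f m) (⌊⌋-false (g ≟ gcdRoot n (+ m))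
        λ g≡L → G∤m (subst (λ l → l ^ s ∣ m) (sym g≡L) (gcdRoot^s∣a n (+ m))))
      onMultiple : ∀ j → ⌊ g ≟ gcdRoot n (+ (g ^ s * suc j)) ⌋ ≡ coprimeᵇ q (suc j)
      onMultiple j = trans (⌊⌋-cong (g ≟ gcdRoot n (+ (g ^ s * suc j))) (Coprimeₛ? q (+ suc j))
                                    (to ∘′ sym) (sym ∘′ from))
                           (sym (coprimeᵇ≡⌊Coprimeₛ?⌋ q (suc j)))
        where open Equivalence (gcdRoot-scaled≡⇔Coprimeₛ n q g n≡qg (suc j))

  ∑-by-gcdRoot : ∀ n .{{_ : NonZero n}} (f : ℕ → ℕ) →
    ∑[ i < n ^ s ] f (suc i) ≡ ∑[ g ∣ n ] ∑[ j < quot n g ^ s ] (𝟙 (coprimeᵇ (quot n g) (suc j)) * f (g ^ s * suc j))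
  ∑-by-gcdRoot n f = begin
    ∑[ i < n ^ s ] f (suc i)
      ≡⟨ ∑-cong (n ^ s) (λ i _ → sym (∑-𝟙≟ n (gcdRoot n (+ suc i)) {{gcdRoot≢0 n (+ suc i)}} (f (suc i))
                                            (∣⇒≤ (gcdRoot∣n n (+ suc i))))) ⟩
    ∑[ i < n ^ s ] ∑[ g < n ] h g (suc i)
      ≡⟨ ∑-comm (n ^ s) n (λ i g → h g (suc i)) ⟩
    ∑[ g < n ] ∑[ i < n ^ s ] h g (suc i)
      ≡⟨ ∑-cong n (λ g _ → fibre g) ⟩
    ∑[ g ∣ n ] ∑[ j < quot n g ^ s ] (𝟙 (coprimeᵇ (quot n g) (suc j)) * f (g ^ s * suc j))
      ∎
    where
      open ≡-Reasoning
      h : ℕ → ℕ → ℕ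
      h g m = 𝟙 ⌊ suc g ≟ gcdRoot n (+ m) ⌋ * f m
      fibre : ∀ g → ∑[ i < n ^ s ] h g (suc i) ≡ (if ⌊ suc g ∣? n ⌋
        then ∑[ j < quot n (suc g) ^ s ] (𝟙 (coprimeᵇ (quot n (suc g)) (suc j)) * f (suc g ^ s * suc j)) else 0)
      fibre g with suc g ∣? n
      ... | no g∤n = ∑-zero (n ^ s) _ λ i _ → cong (λ b → 𝟙 b * f (suc i))
              (⌊⌋-false (suc g ≟ gcdRoot n (+ suc i)) λ g≡L → g∤n (subst (_∣ n) (sym g≡L) (gcdRoot∣n n (+ suc i))))
      ... | yes (divides q n≡qg) = trans (∑-gcdRoot≡ n q (suc g) n≡qg f)
              (cong (λ k → ∑[ j < k ^ s ] (𝟙 (coprimeᵇ k (suc j)) * f (suc g ^ s * suc j))) (sym (quot-cofactor n≡qg)))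

-- Counting residues

𝟙[_∣_] : ℕ → ℤ → ℕ
𝟙[ D ∣ x ] = 𝟙 ⌊ D ∣? ∣ x ∣ ⌋

𝟙[∣]-true : ∀ {D x} → + D ∣ℤ x → 𝟙[ D ∣ x ] ≡ 1
𝟙[∣]-true {D} {x} D∣x = cong 𝟙 (⌊⌋-true (D ∣? ∣ x ∣) (∣⇒∣ᵤ D∣x))

𝟙[∣]-false : ∀ {D x} → ¬ + D ∣ℤ x → 𝟙[ D ∣ x ] ≡ 0
𝟙[∣]-false {D} {x} D∤x = cong 𝟙 (⌊⌋-false (D ∣? ∣ x ∣) (D∤x ∘ ∣ᵤ⇒∣))

𝟙[∣]-cong : ∀ {D x y} → (+ D ∣ℤ x → + D ∣ℤ y) → (+ D ∣ℤ y → + D ∣ℤ x) → 𝟙[ D ∣ x ] ≡ 𝟙[ D ∣ y ]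
𝟙[∣]-cong {D} {x} {y} x→y y→x = cong 𝟙 (⌊⌋-cong (D ∣? ∣ x ∣) (D ∣? ∣ y ∣) (∣⇒∣ᵤ ∘ x→y ∘ ∣ᵤ⇒∣) (∣⇒∣ᵤ ∘ y→x ∘ ∣ᵤ⇒∣))

𝟙[∣]-swap : ∀ D x y → 𝟙[ D ∣ x ℤ.- y ] ≡ 𝟙[ D ∣ y ℤ.- x ]
𝟙[∣]-swap D x y = cong (λ z → 𝟙 ⌊ D ∣? z ⌋) (trans (sym (ℤ.∣-i∣≡∣i∣ (x ℤ.- y))) (cong ∣_∣ (neg-sub x y)))
  where
    neg-sub : ∀ x y → ℤ.- (x ℤ.- y) ≡ y ℤ.- x
    neg-sub = ℤ-Ring.solve-∀

∣m⊖n∣≡∣m-n∣ : ∀ m n → ∣ m ⊖ n ∣ ≡ ℕ.∣ m - n ∣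
∣m⊖n∣≡∣m-n∣ zero    zero    = refl
∣m⊖n∣≡∣m-n∣ zero    (suc n) = refl
∣m⊖n∣≡∣m-n∣ (suc m) zero    = refl
∣m⊖n∣≡∣m-n∣ (suc m) (suc n) = trans (cong ∣_∣ (ℤ.[1+m]⊖[1+n]≡m⊖n m n)) (∣m⊖n∣≡∣m-n∣ m n)

∣∧<⇒≡0 : ∀ {d k} → d ∣ k → k < d → k ≡ 0
∣∧<⇒≡0 {k = zero}  _   _   = refl
∣∧<⇒≡0 {k = suc k} d∣k k<d = contradiction (∣⇒≤ d∣k) (<⇒≱ k<d)

residue-unique : ∀ {D i j} → i < D → j < D → + D ∣ℤ + i ℤ.- + j → i ≡ j
residue-unique {D} {i} {j} i<D j<D D∣i-j = ∣m-n∣≡0⇒m≡n (∣∧<⇒≡0 D∣∣i-j∣ (≤-<-trans (∣m-n∣≤m⊔n i j) (⊔-lub i<D j<D)))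
  where
    D∣∣i-j∣ : D ∣ ℕ.∣ i - j ∣
    D∣∣i-j∣ = subst (D ∣_) (trans (cong ∣_∣ (ℤ.[+m]-[+n]≡m⊖n i j)) (∣m⊖n∣≡∣m-n∣ i j)) (∣⇒∣ᵤ D∣i-j)

∑-residue : ∀ D .{{_ : NonZero D}} x → ∑[ i < D ] 𝟙[ D ∣ + suc i ℤ.- x ] ≡ 1
∑-residue D x = trans (∑-single D (λ i → 𝟙[ D ∣ + suc i ℤ.- x ]) r (n%ℕd<d (x ℤ.- + 1) D) others) (𝟙[∣]-true D∣r)
  where
    open ≡-Reasoning
    r = (x ℤ.- + 1) %ℕ D
    q = (x ℤ.- + 1) /ℕ D
    D∣r : + D ∣ℤ + suc r ℤ.- x
    D∣r = divides (ℤ.- q) (begin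
      + 1 ℤ.+ + r ℤ.- x
        ≡⟨ shift (+ r) x q (+ D) ⟩
      (+ r ℤ.+ q ℤ.* + D ℤ.- (x ℤ.- + 1)) ℤ.+ ℤ.- q ℤ.* + D
        ≡⟨ cong (λ y → (y ℤ.- (x ℤ.- + 1)) ℤ.+ ℤ.- q ℤ.* + D) (sym (a≡a%ℕn+[a/ℕn]*n (x ℤ.- + 1) D)) ⟩
      (x ℤ.- + 1 ℤ.- (x ℤ.- + 1)) ℤ.+ ℤ.- q ℤ.* + D
        ≡⟨ cancel (x ℤ.- + 1) (ℤ.- q ℤ.* + D) ⟩
      ℤ.- q ℤ.* + D
        ∎)
      where
        shift : ∀ r x q D → + 1 ℤ.+ r ℤ.- x ≡ (r ℤ.+ q ℤ.* D ℤ.- (x ℤ.- + 1)) ℤ.+ ℤ.- q ℤ.* D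
        shift = ℤ-Ring.solve-∀
        cancel : ∀ y z → y ℤ.- y ℤ.+ z ≡ z
        cancel = ℤ-Ring.solve-∀
    others : ∀ i → i < D → i ≢ r → 𝟙[ D ∣ + suc i ℤ.- x ] ≡ 0
    others i i<D i≢r = 𝟙[∣]-false {D} {+ suc i ℤ.- x} λ D∣i → i≢r (residue-unique i<D (n%ℕd<d (x ℤ.- + 1) D)
      (subst (+ D ∣ℤ_) (difference (+ i) (+ r) x) (ℤ∣.∣m∣n⇒∣m-n {+ D} {+ suc i ℤ.- x} D∣i D∣r)))
      where
        difference : ∀ i r x → (+ 1 ℤ.+ i ℤ.- x) ℤ.- (+ 1 ℤ.+ r ℤ.- x) ≡ i ℤ.- r
        difference = ℤ-Ring.solve-∀

∑-residues : ∀ q D .{{_ : NonZero D}} a → ∑[ i < q * D ] 𝟙[ D ∣ + suc i ℤ.- a ] ≡ q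
∑-residues q D a = begin
  ∑[ i < q * D ] 𝟙[ D ∣ + suc i ℤ.- a ]
    ≡⟨ ∑-blocks q D _ ⟩
  ∑[ t < q ] ∑[ i < D ] 𝟙[ D ∣ + suc (t * D + i) ℤ.- a ]
    ≡⟨ ∑-cong q (λ t _ → trans (∑-cong D λ i _ → cong 𝟙[ D ∣_] (shift t i)) (∑-residue D (a ℤ.- + (t * D)))) ⟩
  ∑[ t < q ] 1
    ≡⟨ ∑-1 q ⟩
  q
    ∎
  where
    open ≡-Reasoning
    shift : ∀ t i → + suc (t * D + i) ℤ.- a ≡ + suc i ℤ.- (a ℤ.- + (t * D))
    shift t i = trans (cong (λ k → + k ℤ.- a) (sym (+-suc (t * D) i))) (rearrange (+ (t * D)) (+ suc i) a)
      where
        rearrange : ∀ y z a → (y ℤ.+ z) ℤ.- a ≡ z ℤ.- (a ℤ.- y)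
        rearrange = ℤ-Ring.solve-∀

inverse-mod : ∀ {G D} → Coprime G D → ∃ λ u → + D ∣ℤ u ℤ.* + G ℤ.- + 1
inverse-mod {G} {D} G⊥D with coprime-Bézout G⊥D
... | Bézout.+- x y 1+yD≡xG = + x , divides (+ y) (begin
  + x ℤ.* + G ℤ.- + 1         ≡⟨ cong (ℤ._- + 1) (sym (ℤ.pos-* x G)) ⟩
  + (x * G) ℤ.- + 1           ≡⟨ cong (λ k → + k ℤ.- + 1) (sym 1+yD≡xG) ⟩
  + (1 + y * D) ℤ.- + 1       ≡⟨ cong (ℤ._- + 1) (ℤ.pos-+ 1 (y * D)) ⟩
  + 1 ℤ.+ + (y * D) ℤ.- + 1   ≡⟨ cancel (+ (y * D)) ⟩
  + (y * D)                   ≡⟨ ℤ.pos-* y D ⟩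
  + y ℤ.* + D                 ∎)
  where
    open ≡-Reasoning
    cancel : ∀ z → + 1 ℤ.+ z ℤ.- + 1 ≡ z
    cancel = ℤ-Ring.solve-∀
... | Bézout.-+ x y 1+xG≡yD = - + x , divides (- + y) (begin
  - + x ℤ.* + G ℤ.- + 1       ≡⟨ negate (+ x) (+ G) ⟩
  - (+ 1 ℤ.+ + x ℤ.* + G)     ≡⟨ cong (λ z → - (+ 1 ℤ.+ z)) (sym (ℤ.pos-* x G)) ⟩
  - (+ 1 ℤ.+ + (x * G))       ≡⟨ cong -_ (sym (ℤ.pos-+ 1 (x * G))) ⟩
  - + (1 + x * G)             ≡⟨ cong (λ k → - + k) 1+xG≡yD ⟩
  - + (y * D)                 ≡⟨ cong -_ (ℤ.pos-* y D) ⟩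
  - (+ y ℤ.* + D)             ≡⟨ ℤ.neg-distribˡ-* (+ y) (+ D) ⟩
  - + y ℤ.* + D               ∎)
  where
    open ≡-Reasoning
    negate : ∀ x g → - x ℤ.* g ℤ.- + 1 ≡ - (+ 1 ℤ.+ x ℤ.* g)
    negate = ℤ-Ring.solve-∀

∣-scale⇔ : ∀ {D G u} → + D ∣ℤ u ℤ.* + G ℤ.- + 1 → ∀ x a →
  + D ∣ℤ + G ℤ.* x ℤ.- a ⇔ + D ∣ℤ x ℤ.- u ℤ.* a
∣-scale⇔ {D} {G} {u} D∣uG-1 x a = mk⇔
  (λ D∣Gx-a → subst (+ D ∣ℤ_) (unscale u (+ G) x a)
     (ℤ∣.∣m∣n⇒∣m-n (ℤ∣.∣n⇒∣m*n u D∣Gx-a) (ℤ∣.∣m⇒∣m*n x D∣uG-1)))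
  (λ D∣x-ua → subst (+ D ∣ℤ_) (rescale u (+ G) x a)
     (ℤ∣.∣m∣n⇒∣m+n (ℤ∣.∣n⇒∣m*n (+ G) D∣x-ua) (ℤ∣.∣n⇒∣m*n a D∣uG-1)))
  where
    unscale : ∀ u g x a → u ℤ.* (g ℤ.* x ℤ.- a) ℤ.- (u ℤ.* g ℤ.- + 1) ℤ.* x ≡ x ℤ.- u ℤ.* a
    unscale = ℤ-Ring.solve-∀
    rescale : ∀ u g x a → g ℤ.* (x ℤ.- u ℤ.* a) ℤ.+ a ℤ.* (u ℤ.* g ℤ.- + 1) ≡ g ℤ.* x ℤ.- a
    rescale = ℤ-Ring.solve-∀

-- s-coprime numbers in a residue class

module _ (s : ℕ) .{{_ : NonZero s}} where

  Φ≡∑ : ∀ N → Φ s N ≡ ∑[ i < N ] 𝟙 (gcdₛ s (+ suc i ∷ + N ∷ []) ≡ᵇ 1)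
  Φ≡∑ N = listSum-applyUpTo N _ suc

  φ : ℕ → ℕ
  φ d = Φ s (d ^ s)

  φ≡∑ : ∀ d → φ d ≡ ∑[ i < d ^ s ] 𝟙 (coprimeᵇ s d (suc i))
  φ≡∑ d = Φ≡∑ (d ^ s)

  φ≢0 : ∀ d .{{_ : NonZero d}} → NonZero (φ d)
  φ≢0 d = subst NonZero (sym (Φ≡∑ (d ^ s)))
    (firstTerm (d ^ s) {{m^n≢0 d s}} (Coprimeₛ⇒coprimeᵇ s d 1 λ e _ e^s∣1 → m^k≡1⇒m≡1 e (∣1⇒≡1 e^s∣1)))
    where
      firstTerm : ∀ D .{{_ : NonZero D}} → coprimeᵇ s d 1 ≡ true → NonZero (∑[ i < D ] 𝟙 (coprimeᵇ s d (suc i)))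
      firstTerm (suc D) 1⊥d rewrite 1⊥d = _

  Coprimeₛ-congruent : ∀ {n d m i} → d ∣ n → Coprimeₛ s n m → + (d ^ s) ∣ℤ i ℤ.- m → Coprimeₛ s d i
  Coprimeₛ-congruent {n} {d} {m} {i} d∣n m⊥n D∣i-m e e∣d e^s∣i = m⊥n e (∣-trans e∣d d∣n) (∣⇒∣ᵤ {+ (e ^ s)} {m}
    (subst (+ (e ^ s) ∣ℤ_) (sub-sub i m) (ℤ∣.∣m∣n⇒∣m-n (∣ᵤ⇒∣ {+ (e ^ s)} {i} e^s∣i)
      (ℤ∣.∣-trans (∣ᵤ⇒∣ {+ (e ^ s)} {+ (d ^ s)} (^-monoˡ-∣ s e∣d)) D∣i-m))))
    where
      sub-sub : ∀ x y → x ℤ.- (x ℤ.- y) ≡ y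
      sub-sub = ℤ-Ring.solve-∀

  residueCount : ℕ → ℕ → ℤ → ℕ
  residueCount n d a = ∑[ i < n ^ s ] (𝟙 (coprimeᵇ s n (suc i)) * 𝟙[ d ^ s ∣ + suc i ℤ.- a ])

  ∑-residueCount : ∀ n .{{_ : NonZero n}} d → d ∣ n →
    ∑[ i < d ^ s ] (𝟙 (coprimeᵇ s d (suc i)) * residueCount n d (+ suc i)) ≡ Φ s (n ^ s)
  ∑-residueCount n d d∣n = begin
    ∑[ i < D ] (c i * ∑[ m < n ^ s ] (b m * I m i))
      ≡⟨ ∑-cong D (λ i _ → *-distribˡ-∑ (n ^ s) (c i) _) ⟩
    ∑[ i < D ] ∑[ m < n ^ s ] (c i * (b m * I m i))
      ≡⟨ ∑-comm D (n ^ s) _ ⟩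
    ∑[ m < n ^ s ] ∑[ i < D ] (c i * (b m * I m i))
      ≡⟨ ∑-cong (n ^ s) (λ m _ → trans (∑-cong D λ i _ → x∙yz≈y∙xz (c i) (b m) _) (sym (*-distribˡ-∑ D (b m) _))) ⟩
    ∑[ m < n ^ s ] (b m * ∑[ i < D ] (c i * I m i))
      ≡⟨ ∑-cong (n ^ s) (λ m _ → uniqueClass m) ⟩
    ∑[ m < n ^ s ] b m
      ≡⟨ Φ≡∑ (n ^ s) ⟨
    Φ s (n ^ s)
      ∎
    where
      open ≡-Reasoning
      instance
        _ = m^n≢0 n s
        _ = divisor≢0 d∣n
      D = d ^ s
      c b : ℕ → ℕ
      c i = 𝟙 (coprimeᵇ s d (suc i))
      b m = 𝟙 (coprimeᵇ s n (suc m))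
      I : ℕ → ℕ → ℕ
      I m i = 𝟙[ D ∣ + suc m ℤ.- + suc i ]
      -- an s-coprime m lies in exactly one class mod d^s, and that class is s-coprime to d
      uniqueClass : ∀ m → b m * ∑[ i < D ] (c i * I m i) ≡ b m
      uniqueClass m with coprimeᵇ s n (suc m) in m⊥n
      ... | false = refl
      ... | true  = trans (+-identityʳ _)
                      (trans (∑-cong D λ i _ → classCoprime i) (∑-residue D {{m^n≢0 d s}} (+ suc m)))
        where
          classCoprime : ∀ i → c i * I m i ≡ 𝟙[ D ∣ + suc i ℤ.- + suc m ]
          classCoprime i rewrite 𝟙[∣]-swap D (+ suc m) (+ suc i) with D ∣? ∣ + suc i ℤ.- + suc m ∣
          ... | no  _     = *-zeroʳ (c i)
          ... | yes D∣i-m = cong (λ β → 𝟙 β * 1) (Coprimeₛ⇒coprimeᵇ s d (suc i)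
                              (Coprimeₛ-congruent {n} {d} {+ suc m} {+ suc i} d∣n (coprimeᵇ⇒Coprimeₛ s n (suc m) m⊥n)
                                (∣ᵤ⇒∣ {+ D} {+ suc i ℤ.- + suc m} D∣i-m)))

  ResidueLemma : ℕ → Set
  ResidueLemma n = .{{_ : NonZero n}} → ∀ d → d ∣ n → ∀ a → Coprimeₛ s d a → φ d * residueCount n d a ≡ Φ s (n ^ s)

  scaledCount : ℕ → ℕ → ℤ → ℕ → ℕ
  scaledCount n d a g =
    ∑[ j < quot n g ^ s ] (𝟙 (coprimeᵇ s (quot n g) (suc j)) * 𝟙[ d ^ s ∣ + (g ^ s * suc j) ℤ.- a ])

  Coprimeₛ-*-unit : ∀ {d G u a} → + (d ^ s) ∣ℤ u ℤ.* + G ℤ.- + 1 → Coprimeₛ s d a → Coprimeₛ s d (u ℤ.* a)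
  Coprimeₛ-*-unit {d} {G} {u} {a} D∣uG-1 a⊥d e e∣d e^s∣ua =
    a⊥d e e∣d (coprime-divisor e^s⊥u (subst (e ^ s ∣_) (ℤ.abs-* u a) e^s∣ua))
    where
      e^s⊥u : Coprime (e ^ s) ∣ u ∣
      e^s⊥u {c} (c∣e^s , c∣u) = ∣1⇒≡1 (∣⇒∣ᵤ {+ c} {+ 1} (subst (+ c ∣ℤ_) (uG-[uG-1] u (+ G))
        (ℤ∣.∣m∣n⇒∣m-n (ℤ∣.∣m⇒∣m*n (+ G) (∣ᵤ⇒∣ {+ c} {u} c∣u))
                      (ℤ∣.∣-trans (∣ᵤ⇒∣ {+ c} {+ (d ^ s)} (∣-trans c∣e^s (^-monoˡ-∣ s e∣d))) D∣uG-1))))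
        where
          uG-[uG-1] : ∀ u g → u ℤ.* g ℤ.- (u ℤ.* g ℤ.- + 1) ≡ + 1
          uG-[uG-1] = ℤ-Ring.solve-∀

  scaledCount≡0 : ∀ n d a g → Coprimeₛ s d a → gcd g d ≢ 1 → scaledCount n d a g ≡ 0
  scaledCount≡0 n d a g a⊥d h≢1 = ∑-zero (quot n g ^ s) _ λ j _ →
    trans (cong (𝟙 (coprimeᵇ s (quot n g) (suc j)) *_) (𝟙[∣]-false (h^s∤ (suc j))))
          (*-zeroʳ (𝟙 (coprimeᵇ s (quot n g) (suc j))))
    where
      h = gcd g d
      h^s∤ : ∀ x → ¬ + (d ^ s) ∣ℤ + (g ^ s * x) ℤ.- a
      h^s∤ x D∣Gx-a = h≢1 (a⊥d h (gcd[m,n]∣n g d) (∣⇒∣ᵤ {+ (h ^ s)} {a}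
        (subst (+ (h ^ s) ∣ℤ_) (sub-sub (+ (g ^ s * x)) a) (ℤ∣.∣m∣n⇒∣m-n
          (∣ᵤ⇒∣ {+ (h ^ s)} {+ (g ^ s * x)} (∣-trans (^-monoˡ-∣ s (gcd[m,n]∣m g d)) (m∣m*n x)))
          (ℤ∣.∣-trans (∣ᵤ⇒∣ {+ (h ^ s)} {+ (d ^ s)} (^-monoˡ-∣ s (gcd[m,n]∣n g d))) D∣Gx-a)))))
        where
          sub-sub : ∀ x y → x ℤ.- (x ℤ.- y) ≡ y
          sub-sub = ℤ-Ring.solve-∀

  scaledCount≡residueCount : ∀ n q g .{{_ : NonZero g}} d a {u} → n ≡ q * g →
    + (d ^ s) ∣ℤ u ℤ.* + (g ^ s) ℤ.- + 1 → scaledCount n d a g ≡ residueCount q d (u ℤ.* a)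
  scaledCount≡residueCount n q g d a {u} n≡qg D∣uG-1 rewrite quot-cofactor n≡qg =
    ∑-cong (q ^ s) λ j _ → cong (𝟙 (coprimeᵇ s q (suc j)) *_) (𝟙[∣]-cong (to j ∘′ toℤ j) (fromℤ j ∘′ from j))
    where
      open module Scale j = Equivalence (∣-scale⇔ {d ^ s} {g ^ s} {u} D∣uG-1 (+ suc j) a)
      toℤ : ∀ j → + (d ^ s) ∣ℤ + (g ^ s * suc j) ℤ.- a → + (d ^ s) ∣ℤ + (g ^ s) ℤ.* + suc j ℤ.- a
      toℤ j = subst (λ y → + (d ^ s) ∣ℤ y ℤ.- a) (ℤ.pos-* (g ^ s) (suc j))
      fromℤ : ∀ j → + (d ^ s) ∣ℤ + (g ^ s) ℤ.* + suc j ℤ.- a → + (d ^ s) ∣ℤ + (g ^ s * suc j) ℤ.- a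
      fromℤ j = subst (λ y → + (d ^ s) ∣ℤ y ℤ.- a) (sym (ℤ.pos-* (g ^ s) (suc j)))

  φ*scaledCount : ∀ n .{{_ : NonZero n}} → (∀ {q} → q < n → ResidueLemma q) →
    ∀ d → d ∣ n → ∀ a → Coprimeₛ s d a → ∀ g → 1 < g → g ∣ n →
    φ d * scaledCount n d a g ≡ (if ⌊ gcd g d ≟ 1 ⌋ then Φ s (quot n g ^ s) else 0)
  φ*scaledCount n IH d d∣n a a⊥d g 1<g (divides q n≡qg) with gcd g d ≟ 1
  ... | no  h≢1 = trans (cong (φ d *_) (scaledCount≡0 n d a g a⊥d h≢1)) (*-zeroʳ (φ d))
  ... | yes h≡1 = begin
    φ d * scaledCount n d a g         ≡⟨ cong (φ d *_) (scaledCount≡residueCount n q g d a {u} n≡qg D∣uG-1) ⟩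
    φ d * residueCount q d (u ℤ.* a)  ≡⟨ IH q<n d d∣q (u ℤ.* a) (Coprimeₛ-*-unit {d} {g ^ s} {u} D∣uG-1 a⊥d) ⟩
    Φ s (q ^ s)                       ≡⟨ cong (λ k → Φ s (k ^ s)) (quot-cofactor n≡qg) ⟨
    Φ s (quot n g ^ s)                ∎
    where
      open ≡-Reasoning
      instance
        _ = divisor≢0 (divides q n≡qg)
        _ = cofactor≢0 n≡qg
      g⊥d : Coprime g d
      g⊥d = gcd≡1⇒coprime h≡1
      u = proj₁ (inverse-mod (coprime-^ s g⊥d))
      D∣uG-1 = proj₂ (inverse-mod (coprime-^ s g⊥d))
      q<n : q < n
      q<n = subst (q <_) (sym n≡qg) (m<m*n q g 1<g)
      d∣q : d ∣ q
      d∣q = coprime-divisor (Coprime.sym g⊥d) (subst (d ∣_) (trans n≡qg (*-comm q g)) d∣n)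

  -- contributions of the divisors 1 < g ∣ n to the count of m ≡ a (mod d^s); by induction they do not depend on a
  complement : ℕ → ℕ → ℕ
  complement n d = ∑[ e < pred n ]
    (if ⌊ 2 + e ∣? n ⌋ then (if ⌊ gcd (2 + e) d ≟ 1 ⌋ then Φ s (quot n (2 + e) ^ s) else 0) else 0)

  residueCount+complement : ∀ n .{{_ : NonZero n}} → (∀ {q} → q < n → ResidueLemma q) →
    ∀ d q → n ≡ q * d → ∀ a → Coprimeₛ s d a → φ d * residueCount n d a + complement n d ≡ φ d * q ^ s
  residueCount+complement n@(suc n-1) IH d q n≡qd a a⊥d = sym (begin
    φ d * q ^ s
      ≡⟨ cong (φ d *_) (∑-residues (q ^ s) D a) ⟨
    φ d * ∑[ i < q ^ s * D ] 𝟙[ D ∣ + suc i ℤ.- a ]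
      ≡⟨ cong (λ k → φ d * ∑[ i < k ] 𝟙[ D ∣ + suc i ℤ.- a ]) n^s≡q^sD ⟨
    φ d * ∑[ i < n ^ s ] 𝟙[ D ∣ + suc i ℤ.- a ]
      ≡⟨ cong (φ d *_) (∑-by-gcdRoot s n λ m → 𝟙[ D ∣ + m ℤ.- a ]) ⟩
    φ d * (term 0 + ∑[ e < n-1 ] term (suc e))
      ≡⟨ *-distribˡ-+ (φ d) (term 0) _ ⟩
    φ d * term 0 + φ d * ∑[ e < n-1 ] term (suc e)
      ≡⟨ cong₂ _+_ (cong (φ d *_) trivialDivisor) (*-distribˡ-∑ n-1 (φ d) (term ∘′ suc)) ⟩
    φ d * residueCount n d a + ∑[ e < n-1 ] (φ d * term (suc e))
      ≡⟨ cong (λ x → φ d * residueCount n d a + x) (∑-cong n-1 λ e _ → properDivisor e) ⟩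
    φ d * residueCount n d a + complement n d
      ∎)
    where
      open ≡-Reasoning
      D = d ^ s
      instance
        _ = m^n≢0 d s {{divisor≢0 (divides q n≡qd)}}
      n^s≡q^sD : n ^ s ≡ q ^ s * D
      n^s≡q^sD = trans (cong (_^ s) n≡qd) (^-distribʳ-* q d s)
      term : ℕ → ℕ
      term e = if ⌊ suc e ∣? n ⌋ then scaledCount n d a (suc e) else 0
      trivialDivisor : term 0 ≡ residueCount n d a
      trivialDivisor = begin
        term 0
          ≡⟨ cong (λ b → if b then scaledCount n d a 1 else 0) (⌊⌋-true (1 ∣? n) (1∣ n)) ⟩
        scaledCount n d a 1
          ≡⟨ cong (λ k → ∑[ j < k ^ s ] (𝟙 (coprimeᵇ s k (suc j)) * 𝟙[ D ∣ + (1 ^ s * suc j) ℤ.- a ]))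
                  (quot-cofactor (sym (*-identityʳ n))) ⟩
        ∑[ j < n ^ s ] (𝟙 (coprimeᵇ s n (suc j)) * 𝟙[ D ∣ + (1 ^ s * suc j) ℤ.- a ])
          ≡⟨ ∑-cong (n ^ s) (λ j _ → cong (λ k → 𝟙 (coprimeᵇ s n (suc j)) * 𝟙[ D ∣ + k ℤ.- a ])
                  (trans (cong (_* suc j) (^-zeroˡ s)) (*-identityˡ (suc j)))) ⟩
        residueCount n d a
          ∎
      properDivisor : ∀ e → φ d * term (suc e) ≡
        (if ⌊ 2 + e ∣? n ⌋ then (if ⌊ gcd (2 + e) d ≟ 1 ⌋ then Φ s (quot n (2 + e) ^ s) else 0) else 0)
      properDivisor e = trans (*-if (φ d) ⌊ 2 + e ∣? n ⌋ _) (if-cong ⌊ 2 + e ∣? n ⌋ λ g∣n →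
        φ*scaledCount n IH d (divides q n≡qd) a a⊥d (2 + e) (s≤s (s≤s z≤n)) (⌊⌋-true⁻¹ (2 + e ∣? n) g∣n))

  φ*residueCount≡Φ : ∀ n → ResidueLemma n
  φ*residueCount≡Φ = <-rec ResidueLemma step
    where
      step : ∀ n → (∀ {q} → q < n → ResidueLemma q) → ResidueLemma n
      step n IH d d∣n@(divides q n≡qd) a a⊥d =
        sym (*-cancelˡ-≡ (Φ s (n ^ s)) (φ d * A a) (φ d) (+-cancelʳ-≡ _ _ _ averaged))
        where
          open ≡-Reasoning
          instance
            _ = divisor≢0 d∣n
            _ = φ≢0 d
          A = residueCount n d
          S = complement n d
          c : ℕ → ℕ
          c i = 𝟙 (coprimeᵇ s d (suc i))
          completed : ∀ i → c i * (φ d * A (+ suc i) + S) ≡ c i * (φ d * q ^ s)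
          completed i with coprimeᵇ s d (suc i) in i⊥d
          ... | false = refl
          ... | true  = cong (1 *_)
                          (residueCount+complement n IH d q n≡qd (+ suc i) (coprimeᵇ⇒Coprimeₛ s d (suc i) i⊥d))
          -- averaging over the residues a′ coprime to d turns the unknown complement S into φ(d)·S on both sides
          averaged : φ d * Φ s (n ^ s) + φ d * S ≡ φ d * (φ d * A a) + φ d * S
          averaged = begin
            φ d * Φ s (n ^ s) + φ d * S
              ≡⟨ cong₂ (λ x y → φ d * x + y * S) (∑-residueCount n d d∣n) (sym (φ≡∑ d)) ⟨
            φ d * ∑[ i < d ^ s ] (c i * A (+ suc i)) + ∑[ i < d ^ s ] c i * S
              ≡⟨ cong₂ _+_ (trans (*-distribˡ-∑ (d ^ s) (φ d) _) (∑-cong (d ^ s) λ i _ → x∙yz≈y∙xz (φ d) (c i) _))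
                           (*-distribʳ-∑ (d ^ s) S c) ⟩
            ∑[ i < d ^ s ] (c i * (φ d * A (+ suc i))) + ∑[ i < d ^ s ] (c i * S)
              ≡⟨ ∑-distrib-+ (d ^ s) _ _ ⟨
            ∑[ i < d ^ s ] (c i * (φ d * A (+ suc i)) + c i * S)
              ≡⟨ ∑-cong (d ^ s) (λ i _ → trans (sym (*-distribˡ-+ (c i) _ S)) (completed i)) ⟩
            ∑[ i < d ^ s ] (c i * (φ d * q ^ s))
              ≡⟨ trans (cong (_* (φ d * q ^ s)) (φ≡∑ d)) (*-distribʳ-∑ (d ^ s) _ c) ⟨
            φ d * (φ d * q ^ s)
              ≡⟨ cong (φ d *_) (residueCount+complement n IH d q n≡qd a a⊥d) ⟨
            φ d * (φ d * A a + S)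
              ≡⟨ *-distribˡ-+ (φ d) _ S ⟩
            φ d * (φ d * A a) + φ d * S
              ∎

  ^≡∑-dvd-φ : ∀ L .{{_ : NonZero L}} → L ^ s ≡ ∑[ e ∣ L ] φ e
  ^≡∑-dvd-φ L = begin
    L ^ s
      ≡⟨ ∑-1 (L ^ s) ⟨
    ∑[ _ < L ^ s ] 1
      ≡⟨ ∑-by-gcdRoot s L (λ _ → 1) ⟩
    ∑[ g ∣ L ] ∑[ j < quot L g ^ s ] (𝟙 (coprimeᵇ s (quot L g) (suc j)) * 1)
      ≡⟨ ∑-cong L (λ g _ → if-cong ⌊ suc g ∣? L ⌋ λ _ →
           trans (∑-cong (quot L (suc g) ^ s) λ j _ → *-identityʳ _) (sym (φ≡∑ (quot L (suc g))))) ⟩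
    ∑[ g ∣ L ] φ (quot L g)
      ≡⟨ ∑-dvd-flip L (φ) (>-nonZero⁻¹ L) ⟩
    ∑[ e ∣ L ] φ e
      ∎
    where open ≡-Reasoning

  gcdₛ-expansion : ∀ n .{{_ : NonZero n}} xs → + (n ^ s) ∈ xs →
    gcdₛ s xs ≡ ∑[ e < n ] (𝟙 (dividesAll (suc e ^ s) xs) * φ (suc e))
  gcdₛ-expansion n xs n^s∈xs = begin
    gcdₛ s xs
      ≡⟨ gcdₛ≡root^s ⟩
    L ^ s
      ≡⟨ ^≡∑-dvd-φ L ⟩
    ∑[ e ∣ L ] φ e
      ≡⟨ ∑-truncate _ L≤n beyondL ⟨
    ∑[ e < n ] (if ⌊ suc e ∣? L ⌋ then φ (suc e) else 0)
      ≡⟨ ∑-cong n (λ e _ → trans (cong (λ b → if b then φ (suc e) else 0) (divisor⇔common e))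
                                 (sym (𝟙-* (dividesAll (suc e ^ s) xs) (φ (suc e))))) ⟩
    ∑[ e < n ] (𝟙 (dividesAll (suc e ^ s) xs) * φ (suc e))
      ∎
    where
      open ≡-Reasoning
      instance
        _ = m^n≢0 n s
      open GcdRoot (gcdₛ-root s xs n^s∈xs) renaming (root to L)
      instance _ = root≢0
      L≤n : L ≤ n
      L≤n = ∣⇒≤ (m^k∣n^k⇒m∣n (All.lookup root^s∣xs n^s∈xs))
      beyondL : ∀ e → L ≤ e → (if ⌊ suc e ∣? L ⌋ then φ (suc e) else 0) ≡ 0
      beyondL e L≤e rewrite ⌊⌋-false (suc e ∣? L) (λ e+1∣L → <⇒≱ (s≤s L≤e) (∣⇒≤ e+1∣L)) = refl
      divisor⇔common : ∀ e → ⌊ suc e ∣? L ⌋ ≡ dividesAll (suc e ^ s) xs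
      divisor⇔common e = trans (⌊⌋-cong (suc e ∣? L) (All.all? (λ x → suc e ^ s ∣? ℤ.∣ x ∣) xs)
                                  (λ e∣L → All.map (∣-trans (^-monoˡ-∣ s e∣L)) root^s∣xs) (greatest (suc e)))
                               (sym (dividesAll≡⌊all?⌋ (suc e ^ s) xs))

-- The left-hand side as a divisor sum

dividesAll-++ : ∀ c xs ys → dividesAll c (xs ++ ys) ≡ dividesAll c xs ∧ dividesAll c ys
dividesAll-++ c []       ys = refl
dividesAll-++ c (x ∷ xs) ys =
  trans (cong (⌊ c ∣? ∣ x ∣ ⌋ ∧_) (dividesAll-++ c xs ys))
        (sym (∧-assoc ⌊ c ∣? ∣ x ∣ ⌋ (dividesAll c xs) (dividesAll c ys)))

∏-replicate : ∀ r x → ∏ (Vec.replicate r x) ≡ x ^ r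
∏-replicate zero    x = refl
∏-replicate (suc r) x = cong (x *_) (∏-replicate r x)

module _ (s : ℕ) .{{_ : NonZero s}} (n : ℕ) .{{_ : NonZero n}} where

  private
    N = n ^ s

  allCoprimeᵇ : ∀ {k} → Vec ℕ k → Bool
  allCoprimeᵇ m = all (coprimeᵇ s n) (Vec.toList m)

  differences : ∀ {k} → Vec ℕ k → Vec ℤ k → List ℤ
  differences m a = Vec.toList (Vec.zipWith (λ mi ai → + mi ℤ.- ai) m a)

  multiples : ℕ → ℕ
  multiples E = ∑[ i < N ] 𝟙 ⌊ E ∣? suc i ⌋

  private
    coprimeCongruent : ℕ → ℤ → ℕ → ℕ
    coprimeCongruent D ai x = 𝟙 (coprimeᵇ s n x) * 𝟙[ D ∣ + x ℤ.- ai ]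

    𝟙-coprime-congruent≡∏ : ∀ {k} D (m : Vec ℕ k) a →
      𝟙 (allCoprimeᵇ m) * 𝟙 (dividesAll D (differences m a)) ≡
      ∏ (Vec.zipWith _$_ (Vec.map (coprimeCongruent D) a) m)
    𝟙-coprime-congruent≡∏ D []       []       = refl
    𝟙-coprime-congruent≡∏ D (x ∷ m) (ai ∷ a) = begin
      𝟙 (coprimeᵇ s n x ∧ allCoprimeᵇ m) * 𝟙 (⌊ D ∣? ∣ + x ℤ.- ai ∣ ⌋ ∧ dividesAll D (differences m a))
        ≡⟨ cong₂ _*_ (𝟙-∧ (coprimeᵇ s n x) (allCoprimeᵇ m))
                     (𝟙-∧ ⌊ D ∣? ∣ + x ℤ.- ai ∣ ⌋ (dividesAll D (differences m a))) ⟩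
      𝟙 (coprimeᵇ s n x) * 𝟙 (allCoprimeᵇ m) * (𝟙[ D ∣ + x ℤ.- ai ] * 𝟙 (dividesAll D (differences m a)))
        ≡⟨ interchange (𝟙 (coprimeᵇ s n x)) (𝟙 (allCoprimeᵇ m)) 𝟙[ D ∣ + x ℤ.- ai ] _ ⟩
      coprimeCongruent D ai x * (𝟙 (allCoprimeᵇ m) * 𝟙 (dividesAll D (differences m a)))
        ≡⟨ cong (coprimeCongruent D ai x *_) (𝟙-coprime-congruent≡∏ D m a) ⟩
      ∏ (Vec.zipWith _$_ (Vec.map (coprimeCongruent D) (ai ∷ a)) (x ∷ m))
        ∎
      where open ≡-Reasoning

    𝟙-multiples≡∏ : ∀ {r} D (b : Vec ℕ r) →
      𝟙 (dividesAll D (map +_ (Vec.toList b))) ≡ ∏ (Vec.zipWith _$_ (Vec.replicate r (λ x → 𝟙 ⌊ D ∣? x ⌋)) b)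
    𝟙-multiples≡∏ D []      = refl
    𝟙-multiples≡∏ D (x ∷ b) = trans (𝟙-∧ ⌊ D ∣? x ⌋ _) (cong (𝟙 ⌊ D ∣? x ⌋ *_) (𝟙-multiples≡∏ D b))

  ∑-coprime-congruent : ∀ {k} d (a : Vec ℤ k) →
    listSum (map (λ m → 𝟙 (allCoprimeᵇ m) * 𝟙 (dividesAll (d ^ s) (differences m a))) (tuples k N)) ≡
    ∏ (Vec.map (residueCount s n d) a)
  ∑-coprime-congruent {k} d a = begin
    listSum (map (λ m → 𝟙 (allCoprimeᵇ m) * 𝟙 (dividesAll (d ^ s) (differences m a))) (tuples k N))
      ≡⟨ listSum-cong (tuples k N) (λ m → 𝟙-coprime-congruent≡∏ (d ^ s) m a) ⟩
    listSum (map (λ m → ∏ (Vec.zipWith _$_ (Vec.map (coprimeCongruent (d ^ s)) a) m)) (tuples k N))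
      ≡⟨ listSum-tuples-∏ k N (Vec.map (coprimeCongruent (d ^ s)) a) ⟩
    ∏ (Vec.map (λ f → ∑[ i < N ] f (suc i)) (Vec.map (coprimeCongruent (d ^ s)) a))
      ≡⟨ cong ∏ (Vec.map-∘ _ _ a) ⟨
    ∏ (Vec.map (residueCount s n d) a)
      ∎
    where open ≡-Reasoning

  ∑-tuples-multiples : ∀ r D →
    listSum (map (λ b → 𝟙 (dividesAll D (map +_ (Vec.toList b)))) (tuples r N)) ≡ multiples D ^ r
  ∑-tuples-multiples r D = begin
    listSum (map (λ b → 𝟙 (dividesAll D (map +_ (Vec.toList b)))) (tuples r N))
      ≡⟨ listSum-cong (tuples r N) (𝟙-multiples≡∏ D) ⟩
    listSum (map (λ b → ∏ (Vec.zipWith _$_ (Vec.replicate r (λ x → 𝟙 ⌊ D ∣? x ⌋)) b)) (tuples r N))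
      ≡⟨ listSum-tuples-∏ r N (Vec.replicate r (λ x → 𝟙 ⌊ D ∣? x ⌋)) ⟩
    ∏ (Vec.map (λ f → ∑[ i < N ] f (suc i)) (Vec.replicate r (λ x → 𝟙 ⌊ D ∣? x ⌋)))
      ≡⟨ cong ∏ (Vec.map-replicate _ _ r) ⟩
    ∏ (Vec.replicate r (multiples D))
      ≡⟨ ∏-replicate r (multiples D) ⟩
    multiples D ^ r
      ∎
    where open ≡-Reasoning

  private
    divisorWeight : ℕ → ℕ
    divisorWeight e = 𝟙 (dividesAll (suc e ^ s) (+ N ∷ [])) * φ s (suc e)

  ∑-gcdₛ-over-tuples : ∀ {k} r (m : Vec ℕ k) a →
    listSum (map (λ b → gcdₛ s (differences m a ++ map +_ (Vec.toList b) ++ + N ∷ [])) (tuples r N)) ≡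
    ∑[ e < n ] (multiples (suc e ^ s) ^ r * (𝟙 (dividesAll (suc e ^ s) (differences m a)) * divisorWeight e))
  ∑-gcdₛ-over-tuples r m a = begin
    listSum (map (λ b → gcdₛ s (Z ++ B b ++ + N ∷ [])) (tuples r N))
      ≡⟨ listSum-cong (tuples r N) expand ⟩
    listSum (map (λ b → ∑[ e < n ] (𝟙 (dividesAll (E e) (B b)) * K e)) (tuples r N))
      ≡⟨ listSum-∑ n (λ b e → 𝟙 (dividesAll (E e) (B b)) * K e) (tuples r N) ⟩
    ∑[ e < n ] listSum (map (λ b → 𝟙 (dividesAll (E e) (B b)) * K e) (tuples r N))
      ≡⟨ ∑-cong n (λ e _ → trans (sym (*-distribʳ-listSum (K e) (λ b → 𝟙 (dividesAll (E e) (B b))) (tuples r N)))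
                                  (cong (_* K e) (∑-tuples-multiples r (E e)))) ⟩
    ∑[ e < n ] (multiples (E e) ^ r * K e)
      ∎
    where
      open ≡-Reasoning
      Z = differences m a
      B : ∀ {r} → Vec ℕ r → List ℤ
      B b = map +_ (Vec.toList b)
      E : ℕ → ℕ
      E e = suc e ^ s
      K : ℕ → ℕ
      K e = 𝟙 (dividesAll (E e) Z) * divisorWeight e
      expand : ∀ b → gcdₛ s (Z ++ B b ++ + N ∷ []) ≡ ∑[ e < n ] (𝟙 (dividesAll (E e) (B b)) * K e)
      expand b = trans (gcdₛ-expansion s n _ (∈-++⁺ʳ Z (∈-++⁺ʳ (B b) (here refl)))) (∑-cong n λ e _ → begin
        𝟙 (dividesAll (E e) (Z ++ B b ++ + N ∷ [])) * φ s (suc e)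
          ≡⟨ cong (λ β → 𝟙 β * φ s (suc e))
               (trans (dividesAll-++ (E e) Z _) (cong (dividesAll (E e) Z ∧_) (dividesAll-++ (E e) (B b) _))) ⟩
        𝟙 (dividesAll (E e) Z ∧ (dividesAll (E e) (B b) ∧ dividesAll (E e) (+ N ∷ []))) * φ s (suc e)
          ≡⟨ cong (_* φ s (suc e)) (trans (𝟙-∧ (dividesAll (E e) Z) _)
               (cong (𝟙 (dividesAll (E e) Z) *_) (𝟙-∧ (dividesAll (E e) (B b)) (dividesAll (E e) (+ N ∷ []))))) ⟩
        𝟙 (dividesAll (E e) Z) * (𝟙 (dividesAll (E e) (B b)) * 𝟙 (dividesAll (E e) (+ N ∷ []))) * φ s (suc e)
          ≡⟨ regroup (𝟙 (dividesAll (E e) Z)) (𝟙 (dividesAll (E e) (B b))) _ (φ s (suc e)) ⟩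
        𝟙 (dividesAll (E e) (B b)) * K e
          ∎)
        where
          regroup : ∀ x y z w → x * (y * z) * w ≡ y * (x * (z * w))
          regroup = ℕ-Ring.solve-∀

  lhs≡∑ : ∀ k r (a : Vec ℤ k) →
    lhs k r n s a ≡
    ∑[ e < n ] (∏ (Vec.map (residueCount s n (suc e)) a) * (multiples (suc e ^ s) ^ r * divisorWeight e))
  lhs≡∑ k r a = begin
    lhs k r n s a
      ≡⟨ listSum-cong (tuples k N) (λ m → sym (𝟙-* (allCoprimeᵇ m) _)) ⟩
    listSum (map (λ m → 𝟙 (allCoprimeᵇ m) * listSum (map (λ b → gcdₛ s (Z m ++ B b ++ + N ∷ [])) (tuples r N)))
                 (tuples k N))
      ≡⟨ listSum-cong (tuples k N) (λ m → trans (cong (𝟙 (allCoprimeᵇ m) *_) (∑-gcdₛ-over-tuples r m a))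
           (trans (*-distribˡ-∑ n (𝟙 (allCoprimeᵇ m)) _) (∑-cong n λ e _ →
             regroup (𝟙 (allCoprimeᵇ m)) (multiples (suc e ^ s) ^ r) (𝟙 (dividesAll (suc e ^ s) (Z m)))
                     (divisorWeight e)))) ⟩
    listSum (map (λ m → ∑[ e < n ] (𝟙 (allCoprimeᵇ m) * 𝟙 (dividesAll (suc e ^ s) (Z m)) * C e)) (tuples k N))
      ≡⟨ listSum-∑ n _ (tuples k N) ⟩
    ∑[ e < n ] listSum (map (λ m → 𝟙 (allCoprimeᵇ m) * 𝟙 (dividesAll (suc e ^ s) (Z m)) * C e) (tuples k N))
      ≡⟨ ∑-cong n (λ e _ → trans (sym (*-distribʳ-listSum (C e) _ (tuples k N)))
                                  (cong (_* C e) (∑-coprime-congruent (suc e) a))) ⟩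
    ∑[ e < n ] (∏ (Vec.map (residueCount s n (suc e)) a) * C e)
      ∎
    where
      open ≡-Reasoning
      Z : Vec ℕ k → List ℤ
      Z m = differences m a
      B : Vec ℕ r → List ℤ
      B b = map +_ (Vec.toList b)
      C : ℕ → ℕ
      C e = multiples (suc e ^ s) ^ r * divisorWeight e
      regroup : ∀ x y z w → x * (y * (z * w)) ≡ x * z * (y * w)
      regroup = ℕ-Ring.solve-∀

  lhs≡∑-dvd : ∀ k r (a : Vec ℤ k) →
    lhs k r n s a ≡ ∑[ d ∣ n ] (∏ (Vec.map (residueCount s n d) a) * (multiples (d ^ s) ^ r * φ s d))
  lhs≡∑-dvd k r a = trans (lhs≡∑ k r a) (∑-cong n λ e _ → begin
    P e * (M e * (𝟙 (dividesAll (suc e ^ s) (+ N ∷ [])) * φ s (suc e)))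
      ≡⟨ cong (λ β → P e * (M e * (𝟙 β * φ s (suc e)))) (commonDivisor e) ⟩
    P e * (M e * (𝟙 ⌊ suc e ∣? n ⌋ * φ s (suc e)))
      ≡⟨ cong (P e *_) (trans (cong (M e *_) (𝟙-* ⌊ suc e ∣? n ⌋ _)) (*-if (M e) ⌊ suc e ∣? n ⌋ _)) ⟩
    P e * (if ⌊ suc e ∣? n ⌋ then M e * φ s (suc e) else 0)
      ≡⟨ *-if (P e) ⌊ suc e ∣? n ⌋ _ ⟩
    (if ⌊ suc e ∣? n ⌋ then P e * (M e * φ s (suc e)) else 0)
      ∎)
    where
      open ≡-Reasoning
      P M : ℕ → ℕ
      P e = ∏ (Vec.map (residueCount s n (suc e)) a)
      M e = multiples (suc e ^ s) ^ r
      commonDivisor : ∀ e → dividesAll (suc e ^ s) (+ N ∷ []) ≡ ⌊ suc e ∣? n ⌋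
      commonDivisor e = trans (dividesAll≡⌊all?⌋ (suc e ^ s) (+ N ∷ []))
        (⌊⌋-cong (All.all? (λ x → suc e ^ s ∣? ∣ x ∣) (+ N ∷ [])) (suc e ∣? n)
                 (λ { (e^s∣N ∷ []) → m^k∣n^k⇒m∣n e^s∣N }) (λ e∣n → ^-monoˡ-∣ s e∣n ∷ []))

-- Passing to ℚ

module ℚΣ = FiniteSum (CommutativeRing.semiring ℚ.+-*-commutativeRing)

toℚᵘ-frac : ∀ a b → ℚ.toℚᵘ (frac a (suc b)) ℚᵘ.≃ mkℚᵘ (+ a) b
toℚᵘ-frac a b = ℚ.toℚᵘ-fromℚᵘ (mkℚᵘ (+ a) b)

frac-+ : ∀ a b → frac (a + b) 1 ≡ frac a 1 ℚ.+ frac b 1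
frac-+ a b = ℚ.toℚᵘ-injective (begin
  ℚ.toℚᵘ (frac (a + b) 1)                   ≈⟨ toℚᵘ-frac (a + b) 0 ⟩
  mkℚᵘ (+ (a + b)) 0                        ≈⟨ *≡* (trans (cong (ℤ._* + 1) (ℤ.pos-+ a b)) (cross (+ a) (+ b))) ⟩
  mkℚᵘ (+ a) 0 ℚᵘ.+ mkℚᵘ (+ b) 0             ≈⟨ ℚᵘ.+-cong (toℚᵘ-frac a 0) (toℚᵘ-frac b 0) ⟨
  ℚ.toℚᵘ (frac a 1) ℚᵘ.+ ℚ.toℚᵘ (frac b 1)   ≈⟨ ℚ.toℚᵘ-homo-+ (frac a 1) (frac b 1) ⟨
  ℚ.toℚᵘ (frac a 1 ℚ.+ frac b 1)            ∎)
  where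
    open import Relation.Binary.Reasoning.Setoid ℚᵘ.≃-setoid
    cross : ∀ x y → (x ℤ.+ y) ℤ.* + 1 ≡ (x ℤ.* + 1 ℤ.+ y ℤ.* + 1) ℤ.* + 1
    cross = ℤ-Ring.solve-∀

frac-* : ∀ p q z w .{{_ : NonZero w}} → p * w ≡ q * z → frac p 1 ≡ frac q 1 ℚ.* frac z w
frac-* p q z (suc w) pw≡qz = ℚ.toℚᵘ-injective (begin
  ℚ.toℚᵘ (frac p 1)                                 ≈⟨ toℚᵘ-frac p 0 ⟩
  mkℚᵘ (+ p) 0                                      ≈⟨ *≡* cross ⟩
  mkℚᵘ (+ q) 0 ℚᵘ.* mkℚᵘ (+ z) w                     ≈⟨ ℚᵘ.*-cong (toℚᵘ-frac q 0) (toℚᵘ-frac z w) ⟨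
  ℚ.toℚᵘ (frac q 1) ℚᵘ.* ℚ.toℚᵘ (frac z (suc w))     ≈⟨ ℚ.toℚᵘ-homo-* (frac q 1) (frac z (suc w)) ⟨
  ℚ.toℚᵘ (frac q 1 ℚ.* frac z (suc w))              ∎)
  where
    open import Relation.Binary.Reasoning.Setoid ℚᵘ.≃-setoid
    cross : + p ℤ.* + (1 * suc w) ≡ (+ q ℤ.* + z) ℤ.* + 1
    cross = trans (cong (λ x → + p ℤ.* + x) (*-identityˡ (suc w)))
            (trans (sym (ℤ.pos-* p (suc w))) (trans (cong +_ pw≡qz)
            (trans (ℤ.pos-* q z) (sym (ℤ.*-identityʳ _)))))

frac-∑ : ∀ n f → frac (∑ n f) 1 ≡ ℚΣ.∑ n (λ e → frac (f e) 1)
frac-∑ zero    f = refl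
frac-∑ (suc n) f = trans (frac-+ (f 0) _) (cong (frac (f 0) 1 ℚ.+_) (frac-∑ n (f ∘′ suc)))

frac-if : ∀ b x → frac (if b then x else 0) 1 ≡ (if b then frac x 1 else 0ℚ)
frac-if true  x = refl
frac-if false x = refl

module _ (s : ℕ) .{{_ : NonZero s}} where

  φ^k*∏residueCount : ∀ {k} n .{{_ : NonZero n}} d → d ∣ n → (a : Vec ℤ k) →
    (∀ i → Coprimeₛ s n (lookup a i)) → φ s d ^ k * ∏ (Vec.map (residueCount s n d) a) ≡ Φ s (n ^ s) ^ k
  φ^k*∏residueCount n d d∣n []       _        = refl
  φ^k*∏residueCount {suc k} n d d∣n (ai ∷ a) coprime = begin
    φ s d * φ s d ^ k * (residueCount s n d ai * ∏ (Vec.map (residueCount s n d) a))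
      ≡⟨ interchange (φ s d) (φ s d ^ k) (residueCount s n d ai) _ ⟩
    φ s d * residueCount s n d ai * (φ s d ^ k * ∏ (Vec.map (residueCount s n d) a))
      ≡⟨ cong₂ _*_ (φ*residueCount≡Φ s n d d∣n ai λ e e∣d → coprime Fin.zero e (∣-trans e∣d d∣n))
                   (φ^k*∏residueCount n d d∣n a (λ i → coprime (Fin.suc i))) ⟩
    Φ s (n ^ s) * Φ s (n ^ s) ^ k
      ∎
    where open ≡-Reasoning

  multiples≡cofactor^s : ∀ n .{{_ : NonZero n}} d q .{{_ : NonZero d}} → n ≡ q * d → multiples s n (d ^ s) ≡ q ^ s
  multiples≡cofactor^s n d q n≡qd = begin
    ∑[ i < n ^ s ] 𝟙 ⌊ d ^ s ∣? suc i ⌋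
      ≡⟨ cong (λ k → ∑[ i < k ] 𝟙 ⌊ d ^ s ∣? suc i ⌋) n^s≡q^sD ⟩
    ∑[ i < q ^ s * d ^ s ] 𝟙 ⌊ d ^ s ∣? suc i ⌋
      ≡⟨ ∑-cong (q ^ s * d ^ s) (λ i _ → cong (λ x → 𝟙 ⌊ d ^ s ∣? x ⌋) (sym (+-identityʳ (suc i)))) ⟩
    ∑[ i < q ^ s * d ^ s ] 𝟙[ d ^ s ∣ + suc i ℤ.- + 0 ]
      ≡⟨ ∑-residues (q ^ s) (d ^ s) {{m^n≢0 d s}} (+ 0) ⟩
    q ^ s
      ∎
    where
      open ≡-Reasoning
      n^s≡q^sD : n ^ s ≡ q ^ s * d ^ s
      n^s≡q^sD = trans (cong (_^ s) n≡qd) (^-distribʳ-* q d s)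

  rhsTerm : ℕ → ℕ → ℕ → ℕ → ℚ
  rhsTerm k r n d = frac ((d ^ s) ^ r) (Φ s (quot (n ^ s) (d ^ s)) ^ (k ∸ 1))

  frac-divisorTerm : ∀ k r n .{{_ : NonZero n}} (a : Vec ℤ (suc k)) → (∀ i → Coprimeₛ s n (lookup a i)) →
    ∀ d → d ∣ n →
    frac (∏ (Vec.map (residueCount s n d) a) * (multiples s n (d ^ s) ^ r * φ s d)) 1 ≡
    frac (Φ s (n ^ s) ^ suc k) 1 ℚ.* rhsTerm (suc k) r n (quot n d)
  frac-divisorTerm k r n a coprime d d∣n@(divides q n≡qd) = begin
    frac (P * (multiples s n (d ^ s) ^ r * φ s d)) 1
      ≡⟨ frac-* (P * (multiples s n (d ^ s) ^ r * φ s d)) (Φ s (n ^ s) ^ suc k) ((q ^ s) ^ r) (φ s d ^ k)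
                {{m^n≢0 (φ s d) k}} cleared ⟩
    frac (Φ s (n ^ s) ^ suc k) 1 ℚ.* frac ((q ^ s) ^ r) (φ s d ^ k)
      ≡⟨ cong (λ x → frac (Φ s (n ^ s) ^ suc k) 1 ℚ.* frac ((q ^ s) ^ r) (Φ s x ^ k)) quot-n^s ⟨
    frac (Φ s (n ^ s) ^ suc k) 1 ℚ.* rhsTerm (suc k) r n q
      ≡⟨ cong (λ x → frac (Φ s (n ^ s) ^ suc k) 1 ℚ.* rhsTerm (suc k) r n x) (quot-cofactor n≡qd) ⟨
    frac (Φ s (n ^ s) ^ suc k) 1 ℚ.* rhsTerm (suc k) r n (quot n d)
      ∎
    where
      open ≡-Reasoning
      instance
        _ = divisor≢0 d∣n
        _ = φ≢0 s d
        _ = m^n≢0 q s {{cofactor≢0 n≡qd}}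
      P = ∏ (Vec.map (residueCount s n d) a)
      quot-n^s : quot (n ^ s) (q ^ s) ≡ d ^ s
      quot-n^s = quot-cofactor (trans (cong (_^ s) n≡qd) (trans (^-distribʳ-* q d s) (*-comm (q ^ s) (d ^ s))))
      cleared : P * (multiples s n (d ^ s) ^ r * φ s d) * φ s d ^ k ≡ Φ s (n ^ s) ^ suc k * (q ^ s) ^ r
      cleared = begin
        P * (multiples s n (d ^ s) ^ r * φ s d) * φ s d ^ k
          ≡⟨ regroup P (multiples s n (d ^ s) ^ r) (φ s d) (φ s d ^ k) ⟩
        multiples s n (d ^ s) ^ r * (φ s d ^ suc k * P)
          ≡⟨ cong₂ (λ x y → x ^ r * y) (multiples≡cofactor^s n d q n≡qd) (φ^k*∏residueCount n d d∣n a coprime) ⟩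
        (q ^ s) ^ r * Φ s (n ^ s) ^ suc k
          ≡⟨ *-comm ((q ^ s) ^ r) (Φ s (n ^ s) ^ suc k) ⟩
        Φ s (n ^ s) ^ suc k * (q ^ s) ^ r
          ∎
        where
          regroup : ∀ p m f g → p * (m * f) * g ≡ m * (f * g * p)
          regroup = ℕ-Ring.solve-∀

  frac-lhs : ∀ k r n .{{_ : NonZero n}} (a : Vec ℤ (suc k)) → (∀ i → Coprimeₛ s n (lookup a i)) →
    frac (lhs (suc k) r n s a) 1 ≡ frac (Φ s (n ^ s) ^ suc k) 1 ℚ.* ℚΣ.∑[ d ∣ n ] rhsTerm (suc k) r n (quot n d)
  frac-lhs k r n a coprime = begin
    frac (lhs (suc k) r n s a) 1
      ≡⟨ cong (λ x → frac x 1) (lhs≡∑-dvd s n (suc k) r a) ⟩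
    frac (∑[ d ∣ n ] X d) 1
      ≡⟨ frac-∑ n _ ⟩
    ℚΣ.∑[ e < n ] frac (if ⌊ suc e ∣? n ⌋ then X (suc e) else 0) 1
      ≡⟨ ℚΣ.∑-cong n (λ e _ → trans (frac-if ⌊ suc e ∣? n ⌋ (X (suc e))) (trans
           (ℚΣ.if-cong ⌊ suc e ∣? n ⌋ λ e∣n → frac-divisorTerm k r n a coprime (suc e) (⌊⌋-true⁻¹ (suc e ∣? n) e∣n))
           (sym (ℚΣ.*-if c ⌊ suc e ∣? n ⌋ _)))) ⟩
    ℚΣ.∑[ e < n ] (c ℚ.* (if ⌊ suc e ∣? n ⌋ then rhsTerm (suc k) r n (quot n (suc e)) else 0ℚ))
      ≡⟨ ℚΣ.*-distribˡ-∑ n c _ ⟨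
    c ℚ.* ℚΣ.∑[ d ∣ n ] rhsTerm (suc k) r n (quot n d)
      ∎
    where
      open ≡-Reasoning
      c = frac (Φ s (n ^ s) ^ suc k) 1
      X : ℕ → ℕ
      X d = ∏ (Vec.map (residueCount s n d) a) * (multiples s n (d ^ s) ^ r * φ s d)

  rhs≡ : ∀ k r n .{{_ : NonZero n}} → rhs k r n s ≡ frac (Φ s (n ^ s) ^ k) 1 ℚ.* ℚΣ.∑[ d ∣ n ] rhsTerm k r n d
  rhs≡ k r n = cong (frac (Φ s (n ^ s) ^ k) 1 ℚ.*_) (trans (ℚΣ.listSum-applyUpTo n _ suc) (ℚΣ.∑-cong n λ e _ →
    cong (λ b → if b then rhsTerm k r n (suc e) else 0ℚ)
         (⌊⌋-cong (suc e ^ s ∣? n ^ s) (suc e ∣? n) m^k∣n^k⇒m∣n (^-monoˡ-∣ s))))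

theorem3p2 : (k r n s : ℕ) → 1 ≤ k → 1 ≤ r → 1 ≤ n → 1 ≤ s →
    (a : Vec ℤ k) →
    (∀ (i : Fin k) → gcdₛ s (lookup a i ∷ + (n ^ s) ∷ []) ≡ 1) →
    frac (lhs k r n s a) 1 ≡ rhs k r n s
theorem3p2 (suc k) r n s _ _ 1≤n 1≤s a gcd≡1 = begin
  frac (lhs (suc k) r n s a) 1
    ≡⟨ frac-lhs s k r n a coprime ⟩
  c ℚ.* ℚΣ.∑[ d ∣ n ] rhsTerm s (suc k) r n (quot n d)
    ≡⟨ cong (c ℚ.*_) (ℚΣ.∑-dvd-flip n (rhsTerm s (suc k) r n) 1≤n) ⟩
  c ℚ.* ℚΣ.∑[ d ∣ n ] rhsTerm s (suc k) r n d
    ≡⟨ rhs≡ s (suc k) r n ⟨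
  rhs (suc k) r n s
    ∎
  where
    open ≡-Reasoning
    instance
      _ = >-nonZero 1≤s
      _ = >-nonZero 1≤n
    c = frac (Φ s (n ^ s) ^ suc k) 1
    coprime : ∀ i → Coprimeₛ s n (lookup a i)
    coprime i = Equivalence.to (gcdₛ≡1⇔Coprimeₛ s n (lookup a i)) (gcd≡1 i)
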